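{- Every well-typed $\lambda\mu$T-term is strongly normalizing: if $\Gamma;\Delta\vdash t:\rho$, then $t\in\mathrm{SN}_{AB}$, i.e. $t$ is strongly normalizing with respect to the full reduction relation $\to\,=\,\to_A\cup\to_B$.
   Context: $\lambda\mu$T: types $\rho ::= \mathbb N\mid\sigma\to\tau$; terms/commands $t,r,s ::= x\mid\lambda x{:}\rho.r\mid ts\mid\mu\alpha{:}\rho.c\mid0\mid\mathsf S\,t\mid\mathsf{nrec}_\rho\ r\ s\ t$, $c::=[\alpha]t$ ($x$ $\lambda$-variables, $\alpha$ $\mu$-variables); $\mathrm{FCV}$: free $\mu$-variables; $\overline n:=\mathsf S^n0$. Typing $\Gamma;\Delta\vdash t:\rho$, $\Gamma;\Delta\vdash c$: $x:\rho\in\Gamma\Rightarrow x:\rho$; $\Gamma,x{:}\sigma;\Delta\vdash t:\tau\Rightarrow\Gamma;\Delta\vdash\lambda x{:}\sigma.t:\sigma\to\tau$; $t:\sigma\to\tau$, $s:\sigma\Rightarrow ts:\tau$; $0:\mathbb N$; $t:\mathbb N\Rightarrow\mathsf St:\mathbb N$; $r:\rho$, $s:\mathbb N\to\rho\to\rho$, $t:\mathbb N\Rightarrow\mathsf{nrec}_\rho\ r\ s\ t:\rho$; $\Gamma;\Delta,\alpha{:}\rho\vdash c\Rightarrow\Gamma;\Delta\vdash\mu\alpha{:}\rho.c:\rho$; $\Gamma;\Delta\vdash t:\rho$, $\alpha:\rho\in\Delta\Rightarrow\Gamma;\Delta\vdash[\alpha]t$. Contexts $E ::= \Box \mid E\,t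 \mid \mathsf S\,E \mid \mathsf{nrec}\ r\ s\ E$; structural substitution $t[\alpha:=\beta E]$ replaces recursively each subcommand $[\alpha]q$ by $[\beta]E[q[\alpha:=\beta E]]$ (capture-avoiding). $\to_A$ is the compatible closure (on terms and commands) of: $(\lambda x.t)r \to t[x:=r]$; $\mathsf S(\mu\alpha.c)\to \mu\alpha.c[\alpha:=\alpha(\mathsf S\Box)]$; $(\mu\alpha.c)s\to\mu\alpha.c[\alpha:=\alpha(\Box s)]$; $\mathsf{nrec}\ r\ s\ 0\to r$; $\mathsf{nrec}\ r\ s\ (\mathsf S\,\overline n)\to s\ \overline n\ (\mathsf{nrec}\ r\ s\ \overline n)$; $\mathsf{nrec}\ r\ s\ (\mu\alpha.c)\to\mu\alpha.c[\alpha:=\alpha(\mathsf{nrec}\ r\ s\ \Box)]$. $\to_B$ is the compatible closure of $\mu\alpha.[\alpha]t\to t$ if $\alpha\notin\mathrm{FCV}(t)$ and $[\alpha]\mu\beta.c\to c[\beta:=\alpha\,\Box]$. $\to_{AB}:=\to_A\cup\to_B$. $\mathrm{SN}_{AB}$ is the inductively defined set: $t\in\mathrm{SN}_{AB}$ if every $t'$ with $t\to_{AB}t'$ lies in $\mathrm{SN}_{AB}$. -}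

module Defs where

-- Syntax, typing and reduction of λμT (Parigot's λμ-calculus with Gödel's T),
-- using de Bruijn indices with two separate namespaces:
-- λ-variables (indexing Γ) and μ-variables (indexing Δ).

open import Data.Nat using (ℕ; zero; suc)
open import Data.Product using (_×_; _,_)
open import Data.List using (List; []; _∷_)

infixr 7 _⇒_
data Ty : Set where
  nat : Ty
  _⇒_ : Ty → Ty → Ty

mutual
  data Tm : Set where
    var  : ℕ → Tm
    lam  : Ty → Tm → Tm
    app  : Tm → Tm → Tm
    mu   : Ty → Cmd → Tm
    `0   : Tm
    `S   : Tm → Tm
    nrec : Ty → Tm → Tm → Tm → Tm

  data Cmd : Set where
    named : ℕ → Tm → Cmd

num : ℕ → Tm
num zero    = `0
num (suc n) = `S (num n)

data ECtx : Set where
  hole  : ECtx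
  appE  : ECtx → Tm → ECtx
  SE    : ECtx → ECtx
  nrecE : Ty → Tm → Tm → ECtx → ECtx

plug : ECtx → Tm → Tm
plug hole           q = q
plug (appE E t)     q = app (plug E q) t
plug (SE E)         q = `S (plug E q)
plug (nrecE ρ r s E) q = nrec ρ r s (plug E q)

liftR : (ℕ → ℕ) → ℕ → ℕ
liftR f zero    = zero
liftR f (suc n) = suc (f n)

mutual
  ren : (ℕ → ℕ) → Tm → Tm
  ren f (var x)         = var (f x)
  ren f (lam ρ t)       = lam ρ (ren (liftR f) t)
  ren f (app t s)       = app (ren f t) (ren f s)
  ren f (mu ρ c)        = mu ρ (renC f c)
  ren f `0              = `0
  ren f (`S t)          = `S (ren f t)
  ren f (nrec ρ r s t)  = nrec ρ (ren f r) (ren f s) (ren f t)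

  renC : (ℕ → ℕ) → Cmd → Cmd
  renC f (named α t) = named α (ren f t)

mutual
  mren : (ℕ → ℕ) → Tm → Tm
  mren f (var x)         = var x
  mren f (lam ρ t)       = lam ρ (mren f t)
  mren f (app t s)       = app (mren f t) (mren f s)
  mren f (mu ρ c)        = mu ρ (mrenC (liftR f) c)
  mren f `0              = `0
  mren f (`S t)          = `S (mren f t)
  mren f (nrec ρ r s t)  = nrec ρ (mren f r) (mren f s) (mren f t)

  mrenC : (ℕ → ℕ) → Cmd → Cmd
  mrenC f (named α t) = named (f α) (mren f t)

renE : (ℕ → ℕ) → ECtx → ECtx
renE f hole            = hole
renE f (appE E t)      = appE (renE f E) (ren f t)
renE f (SE E)          = SE (renE f E)
renE f (nrecE ρ r s E) = nrecE ρ (ren f r) (ren f s) (renE f E)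

mrenE : (ℕ → ℕ) → ECtx → ECtx
mrenE f hole            = hole
mrenE f (appE E t)      = appE (mrenE f E) (mren f t)
mrenE f (SE E)          = SE (mrenE f E)
mrenE f (nrecE ρ r s E) = nrecE ρ (mren f r) (mren f s) (mrenE f E)

liftS : (ℕ → Tm) → ℕ → Tm
liftS σ zero    = var zero
liftS σ (suc n) = ren suc (σ n)

-- going under a μ-binder shifts the μ-variables of the substituted terms
liftSμ : (ℕ → Tm) → ℕ → Tm
liftSμ σ n = mren suc (σ n)

mutual
  sub : (ℕ → Tm) → Tm → Tm
  sub σ (var x)         = σ x
  sub σ (lam ρ t)       = lam ρ (sub (liftS σ) t)
  sub σ (app t s)       = app (sub σ t) (sub σ s)
  sub σ (mu ρ c)        = mu ρ (subC (liftSμ σ) c)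
  sub σ `0              = `0
  sub σ (`S t)          = `S (sub σ t)
  sub σ (nrec ρ r s t)  = nrec ρ (sub σ r) (sub σ s) (sub σ t)

  subC : (ℕ → Tm) → Cmd → Cmd
  subC σ (named α t) = named α (sub σ t)

single : Tm → ℕ → Tm
single r zero    = r
single r (suc n) = var n

-- A structural substitution assigns to each μ-variable i a pair (j , E);
-- every subcommand [i]q is replaced by [j] E[q'] where q' is q with the
-- structural substitution applied recursively.

SSub : Set
SSub = ℕ → ℕ × ECtx

liftλ : SSub → SSub
liftλ s i with s i
... | j , E = j , renE suc E

liftμ : SSub → SSub
liftμ s zero = zero , hole
liftμ s (suc i) with s i
... | j , E = suc j , mrenE suc E

mutual
  ssub : SSub → Tm → Tm
  ssub s (var x)         = var x
  ssub s (lam ρ t)       = lam ρ (ssub (liftλ s) t)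
  ssub s (app t u)       = app (ssub s t) (ssub s u)
  ssub s (mu ρ c)        = mu ρ (ssubC (liftμ s) c)
  ssub s `0              = `0
  ssub s (`S t)          = `S (ssub s t)
  ssub s (nrec ρ r u t)  = nrec ρ (ssub s r) (ssub s u) (ssub s t)

  ssubC : SSub → Cmd → Cmd
  ssubC s (named i q) with s i
  ... | j , E = named j (plug E (ssub s q))

-- c[α:=α E] where α is μ-variable 0 (the binder of the redex);
-- E lives outside the binder, so its μ-variables get shifted by the caller.
selfS : ECtx → SSub
selfS E zero    = zero , E
selfS E (suc i) = suc i , hole

-- c[β:=α □] where β is μ-variable 0 of c and α is the μ-variable a of the
-- outer scope; the binder β disappears, so the other variables are lowered.
renameS : ℕ → SSub
renameS a zero    = a , hole
renameS a (suc i) = i , hole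

-- the A rules.  Binder annotations of reducts are the ones making the
-- reduct well-typed (α changes its type in μapp and μnrec).
data _↦A_ : Tm → Tm → Set where
  β      : ∀ {ρ t r} → app (lam ρ t) r ↦A sub (single r) t
  μS     : ∀ {ρ c} → `S (mu ρ c) ↦A mu ρ (ssubC (selfS (SE hole)) c)
  μapp   : ∀ {σ τ c s} →
           app (mu (σ ⇒ τ) c) s ↦A mu τ (ssubC (selfS (appE hole (mren suc s))) c)
  nrec0  : ∀ {ρ r s} → nrec ρ r s `0 ↦A r
  nrecS  : ∀ {ρ r s} n →
           nrec ρ r s (`S (num n)) ↦A app (app s (num n)) (nrec ρ r s (num n))
  μnrec  : ∀ {ρ σ r s c} →
           nrec ρ r s (mu σ c)
             ↦A mu ρ (ssubC (selfS (nrecE ρ (mren suc r) (mren suc s) hole)) c)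

-- the B rules:  μα.[α]t → t  (α ∉ FCV(t)),  and  [α]μβ.c → c[β:=α □]
-- α ∉ FCV(t) is expressed by t being (the shift of) a term t' not mentioning α.
data _↦Bₜ_ : Tm → Tm → Set where
  μη : ∀ {ρ t} → mu ρ (named zero (mren suc t)) ↦Bₜ t

data _↦Bᶜ_ : Cmd → Cmd → Set where
  μren : ∀ {a ρ c} → named a (mu ρ c) ↦Bᶜ ssubC (renameS a) c

infix 4 _⟶_ _⟶ᶜ_
mutual
  data _⟶_ : Tm → Tm → Set where
    rootA : ∀ {t t'} → t ↦A t' → t ⟶ t'
    rootB : ∀ {t t'} → t ↦Bₜ t' → t ⟶ t'
    ξlam  : ∀ {ρ t t'} → t ⟶ t' → lam ρ t ⟶ lam ρ t'
    ξappL : ∀ {t t' s} → t ⟶ t' → app t s ⟶ app t' s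
    ξappR : ∀ {t s s'} → s ⟶ s' → app t s ⟶ app t s'
    ξmu   : ∀ {ρ c c'} → c ⟶ᶜ c' → mu ρ c ⟶ mu ρ c'
    ξS    : ∀ {t t'} → t ⟶ t' → `S t ⟶ `S t'
    ξnrec₁ : ∀ {ρ r r' s t} → r ⟶ r' → nrec ρ r s t ⟶ nrec ρ r' s t
    ξnrec₂ : ∀ {ρ r s s' t} → s ⟶ s' → nrec ρ r s t ⟶ nrec ρ r s' t
    ξnrec₃ : ∀ {ρ r s t t'} → t ⟶ t' → nrec ρ r s t ⟶ nrec ρ r s t'

  data _⟶ᶜ_ : Cmd → Cmd → Set where
    rootBᶜ : ∀ {c c'} → c ↦Bᶜ c' → c ⟶ᶜ c'
    ξnamed : ∀ {α t t'} → t ⟶ t' → named α t ⟶ᶜ named α t'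

data SN-AB (t : Tm) : Set where
  sn : (∀ {t'} → t ⟶ t' → SN-AB t') → SN-AB t

infix 4 _∋_∶_
data _∋_∶_ : List Ty → ℕ → Ty → Set where
  here  : ∀ {Γ ρ} → (ρ ∷ Γ) ∋ zero ∶ ρ
  there : ∀ {Γ ρ σ n} → Γ ∋ n ∶ ρ → (σ ∷ Γ) ∋ suc n ∶ ρ

infix 4 _⨾_⊢_∶_ _⨾_⊢ᶜ_
mutual
  data _⨾_⊢_∶_ (Γ Δ : List Ty) : Tm → Ty → Set where
    ⊢var  : ∀ {x ρ} → Γ ∋ x ∶ ρ → Γ ⨾ Δ ⊢ var x ∶ ρ
    ⊢lam  : ∀ {σ τ t} → (σ ∷ Γ) ⨾ Δ ⊢ t ∶ τ → Γ ⨾ Δ ⊢ lam σ t ∶ σ ⇒ τ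
    ⊢app  : ∀ {σ τ t s} → Γ ⨾ Δ ⊢ t ∶ σ ⇒ τ → Γ ⨾ Δ ⊢ s ∶ σ →
            Γ ⨾ Δ ⊢ app t s ∶ τ
    ⊢0    : Γ ⨾ Δ ⊢ `0 ∶ nat
    ⊢S    : ∀ {t} → Γ ⨾ Δ ⊢ t ∶ nat → Γ ⨾ Δ ⊢ `S t ∶ nat
    ⊢nrec : ∀ {ρ r s t} → Γ ⨾ Δ ⊢ r ∶ ρ → Γ ⨾ Δ ⊢ s ∶ nat ⇒ ρ ⇒ ρ →
            Γ ⨾ Δ ⊢ t ∶ nat → Γ ⨾ Δ ⊢ nrec ρ r s t ∶ ρ
    ⊢mu   : ∀ {ρ c} → Γ ⨾ (ρ ∷ Δ) ⊢ᶜ c → Γ ⨾ Δ ⊢ mu ρ c ∶ ρ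

  data _⨾_⊢ᶜ_ (Γ Δ : List Ty) : Cmd → Set where
    ⊢named : ∀ {α ρ t} → Γ ⨾ Δ ⊢ t ∶ ρ → Δ ∋ α ∶ ρ → Γ ⨾ Δ ⊢ᶜ named α t

module Submission where

-- Strong normalisation of λμT (Theorem 6.34) by a reducibility argument in
-- continuation style.  A term t : ρ is reducible when [b]E[t] is strongly
-- normalising for every reducible context E : ρ ↝ τ and name b : τ, in every
-- extension of Γ and Δ; reducible contexts are defined by recursion on ρ (at ℕ:
-- SN when filled with any numeral; at σ → ρ: □, or E[□ u] with u reducible).

open import Defs
open import Data.Nat using (ℕ; zero; suc; _<_; s≤s)
open import Data.Nat.Properties using (≤-refl)
open import Data.Nat.Induction using (<-wellFounded)
open import Induction.WellFounded using (Acc; acc)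
open import Data.List using (List; []; _∷_; _++_; length)
open import Data.Product using (_×_; _,_; proj₁; proj₂; Σ)
open import Data.Sum using (_⊎_; inj₁; inj₂)
open import Data.Empty using (⊥; ⊥-elim)
open import Function using (_∘_)
open import Relation.Binary.PropositionalEquality
open import Relation.Binary.Construct.Closure.ReflexiveTransitive
  using (Star; ε; _◅_; _◅◅_; gmap; kleisliStar)

-- 1. The generalised substitution

cong₃ : ∀ {A B C D : Set} (h : A → B → C → D) {a a' b b' c c'} →
        a ≡ a' → b ≡ b' → c ≡ c' → h a b c ≡ h a' b' c'
cong₃ h refl refl refl = refl

LSub : Set
LSub = ℕ → Tm

mutual
  gsub : LSub → SSub → Tm → Tm
  gsub σ s (var x)        = σ x
  gsub σ s (lam ρ t)      = lam ρ (gsub (liftS σ) (liftλ s) t)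
  gsub σ s (app t u)      = app (gsub σ s t) (gsub σ s u)
  gsub σ s (mu ρ c)       = mu ρ (gsubC (liftSμ σ) (liftμ s) c)
  gsub σ s `0             = `0
  gsub σ s (`S t)         = `S (gsub σ s t)
  gsub σ s (nrec ρ r u t) = nrec ρ (gsub σ s r) (gsub σ s u) (gsub σ s t)

  gsubC : LSub → SSub → Cmd → Cmd
  gsubC σ s (named i q) = named (proj₁ (s i)) (plug (proj₂ (s i)) (gsub σ s q))

gsubE : LSub → SSub → ECtx → ECtx
gsubE σ s hole            = hole
gsubE σ s (appE E t)      = appE (gsubE σ s E) (gsub σ s t)
gsubE σ s (SE E)          = SE (gsubE σ s E)
gsubE σ s (nrecE ρ r u E) = nrecE ρ (gsub σ s r) (gsub σ s u) (gsubE σ s E)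

compE : ECtx → ECtx → ECtx
compE hole F            = F
compE (appE E t) F      = appE (compE E F) t
compE (SE E) F          = SE (compE E F)
compE (nrecE ρ r u E) F = nrecE ρ r u (compE E F)

plug-compE : ∀ E F q → plug (compE E F) q ≡ plug E (plug F q)
plug-compE hole F q            = refl
plug-compE (appE E t) F q      = cong (λ z → app z t) (plug-compE E F q)
plug-compE (SE E) F q          = cong `S (plug-compE E F q)
plug-compE (nrecE ρ r u E) F q = cong (nrec ρ r u) (plug-compE E F q)

compE-hole : ∀ E → compE E hole ≡ E
compE-hole hole            = refl
compE-hole (appE E t)      = cong (λ z → appE z t) (compE-hole E)
compE-hole (SE E)          = cong SE (compE-hole E)
compE-hole (nrecE ρ r u E) = cong (nrecE ρ r u) (compE-hole E)

gsub-plug : ∀ σ s E q → gsub σ s (plug E q) ≡ plug (gsubE σ s E) (gsub σ s q)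
gsub-plug σ s hole q            = refl
gsub-plug σ s (appE E t) q      = cong (λ z → app z (gsub σ s t)) (gsub-plug σ s E q)
gsub-plug σ s (SE E) q          = cong `S (gsub-plug σ s E q)
gsub-plug σ s (nrecE ρ r u E) q = cong (nrec ρ _ _) (gsub-plug σ s E q)

liftS-cong : ∀ {σ σ'} → σ ≗ σ' → liftS σ ≗ liftS σ'
liftS-cong e zero    = refl
liftS-cong e (suc i) = cong (ren suc) (e i)

liftλ-cong : ∀ {s s'} → s ≗ s' → liftλ s ≗ liftλ s'
liftλ-cong e i rewrite e i = refl

liftSμ-cong : ∀ {σ σ'} → σ ≗ σ' → liftSμ σ ≗ liftSμ σ'
liftSμ-cong e i = cong (mren suc) (e i)

liftμ-cong : ∀ {s s'} → s ≗ s' → liftμ s ≗ liftμ s'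
liftμ-cong e zero = refl
liftμ-cong e (suc i) rewrite e i = refl

mutual
  gsub-cong : ∀ {σ σ' s s'} → σ ≗ σ' → s ≗ s' → ∀ t → gsub σ s t ≡ gsub σ' s' t
  gsub-cong e f (var x)        = e x
  gsub-cong e f (lam ρ t)      = cong (lam ρ) (gsub-cong (liftS-cong e) (liftλ-cong f) t)
  gsub-cong e f (app t u)      = cong₂ app (gsub-cong e f t) (gsub-cong e f u)
  gsub-cong e f (mu ρ c)       = cong (mu ρ) (gsubC-cong (liftSμ-cong e) (liftμ-cong f) c)
  gsub-cong e f `0             = refl
  gsub-cong e f (`S t)         = cong `S (gsub-cong e f t)
  gsub-cong e f (nrec ρ r u t) = cong₃ (nrec ρ) (gsub-cong e f r) (gsub-cong e f u) (gsub-cong e f t)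

  gsubC-cong : ∀ {σ σ' s s'} → σ ≗ σ' → s ≗ s' → ∀ c → gsubC σ s c ≡ gsubC σ' s' c
  gsubC-cong e f (named i q) rewrite f i = cong (λ z → named _ (plug _ z)) (gsub-cong e f q)

renλ : (ℕ → ℕ) → LSub
renλ f i = var (f i)

renμ : (ℕ → ℕ) → SSub
renμ f i = f i , hole

idμ : SSub
idμ i = i , hole

liftS-renλ : ∀ f → liftS (renλ f) ≗ renλ (liftR f)
liftS-renλ f zero    = refl
liftS-renλ f (suc i) = refl

liftS-var : liftS var ≗ var
liftS-var zero    = refl
liftS-var (suc i) = refl

liftλ-idμ : liftλ idμ ≗ idμ
liftλ-idμ i = refl

liftμ-idμ : liftμ idμ ≗ idμ
liftμ-idμ zero    = refl
liftμ-idμ (suc i) = refl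

liftμ-renμ : ∀ f → liftμ (renμ f) ≗ renμ (liftR f)
liftμ-renμ f zero    = refl
liftμ-renμ f (suc i) = refl

mutual
  ren-as-gsub : ∀ f t → ren f t ≡ gsub (renλ f) idμ t
  ren-as-gsub f (var x)        = refl
  ren-as-gsub f (lam ρ t)      =
    cong (lam ρ) (trans (ren-as-gsub (liftR f) t) (gsub-cong (sym ∘ liftS-renλ f) (sym ∘ liftλ-idμ) t))
  ren-as-gsub f (app t u)      = cong₂ app (ren-as-gsub f t) (ren-as-gsub f u)
  ren-as-gsub f (mu ρ c)       =
    cong (mu ρ) (trans (renC-as-gsubC f c) (gsubC-cong (λ i → refl) (sym ∘ liftμ-idμ) c))
  ren-as-gsub f `0             = refl
  ren-as-gsub f (`S t)         = cong `S (ren-as-gsub f t)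
  ren-as-gsub f (nrec ρ r u t) = cong₃ (nrec ρ) (ren-as-gsub f r) (ren-as-gsub f u) (ren-as-gsub f t)

  renC-as-gsubC : ∀ f c → renC f c ≡ gsubC (renλ f) idμ c
  renC-as-gsubC f (named i q) = cong (named i) (ren-as-gsub f q)

mutual
  mren-as-gsub : ∀ f t → mren f t ≡ gsub var (renμ f) t
  mren-as-gsub f (var x)        = refl
  mren-as-gsub f (lam ρ t)      =
    cong (lam ρ) (trans (mren-as-gsub f t) (gsub-cong (sym ∘ liftS-var) (λ i → refl) t))
  mren-as-gsub f (app t u)      = cong₂ app (mren-as-gsub f t) (mren-as-gsub f u)
  mren-as-gsub f (mu ρ c)       =
    cong (mu ρ) (trans (mrenC-as-gsubC (liftR f) c) (gsubC-cong (λ i → refl) (sym ∘ liftμ-renμ f) c))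
  mren-as-gsub f `0             = refl
  mren-as-gsub f (`S t)         = cong `S (mren-as-gsub f t)
  mren-as-gsub f (nrec ρ r u t) = cong₃ (nrec ρ) (mren-as-gsub f r) (mren-as-gsub f u) (mren-as-gsub f t)

  mrenC-as-gsubC : ∀ f c → mrenC f c ≡ gsubC var (renμ f) c
  mrenC-as-gsubC f (named i q) = cong (named (f i)) (mren-as-gsub f q)

mutual
  sub-as-gsub : ∀ σ t → sub σ t ≡ gsub σ idμ t
  sub-as-gsub σ (var x)        = refl
  sub-as-gsub σ (lam ρ t)      =
    cong (lam ρ) (trans (sub-as-gsub (liftS σ) t) (gsub-cong (λ i → refl) (sym ∘ liftλ-idμ) t))
  sub-as-gsub σ (app t u)      = cong₂ app (sub-as-gsub σ t) (sub-as-gsub σ u)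
  sub-as-gsub σ (mu ρ c)       =
    cong (mu ρ) (trans (subC-as-gsubC (liftSμ σ) c) (gsubC-cong (λ i → refl) (sym ∘ liftμ-idμ) c))
  sub-as-gsub σ `0             = refl
  sub-as-gsub σ (`S t)         = cong `S (sub-as-gsub σ t)
  sub-as-gsub σ (nrec ρ r u t) = cong₃ (nrec ρ) (sub-as-gsub σ r) (sub-as-gsub σ u) (sub-as-gsub σ t)

  subC-as-gsubC : ∀ σ c → subC σ c ≡ gsubC σ idμ c
  subC-as-gsubC σ (named i q) = cong (named i) (sub-as-gsub σ q)

mutual
  ssub-as-gsub : ∀ s t → ssub s t ≡ gsub var s t
  ssub-as-gsub s (var x)        = refl
  ssub-as-gsub s (lam ρ t)      =
    cong (lam ρ) (trans (ssub-as-gsub (liftλ s) t) (gsub-cong (sym ∘ liftS-var) (λ i → refl) t))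
  ssub-as-gsub s (app t u)      = cong₂ app (ssub-as-gsub s t) (ssub-as-gsub s u)
  ssub-as-gsub s (mu ρ c)       = cong (mu ρ) (ssubC-as-gsubC (liftμ s) c)
  ssub-as-gsub s `0             = refl
  ssub-as-gsub s (`S t)         = cong `S (ssub-as-gsub s t)
  ssub-as-gsub s (nrec ρ r u t) = cong₃ (nrec ρ) (ssub-as-gsub s r) (ssub-as-gsub s u) (ssub-as-gsub s t)

  ssubC-as-gsubC : ∀ s c → ssubC s c ≡ gsubC var s c
  ssubC-as-gsubC s (named i q) =
    cong (λ z → named (proj₁ (s i)) (plug (proj₂ (s i)) z)) (ssub-as-gsub s q)

renE-as-gsubE : ∀ f E → renE f E ≡ gsubE (renλ f) idμ E
renE-as-gsubE f hole            = refl
renE-as-gsubE f (appE E t)      = cong₂ appE (renE-as-gsubE f E) (ren-as-gsub f t)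
renE-as-gsubE f (SE E)          = cong SE (renE-as-gsubE f E)
renE-as-gsubE f (nrecE ρ r u E) = cong₃ (nrecE ρ) (ren-as-gsub f r) (ren-as-gsub f u) (renE-as-gsubE f E)

mrenE-as-gsubE : ∀ f E → mrenE f E ≡ gsubE var (renμ f) E
mrenE-as-gsubE f hole            = refl
mrenE-as-gsubE f (appE E t)      = cong₂ appE (mrenE-as-gsubE f E) (mren-as-gsub f t)
mrenE-as-gsubE f (SE E)          = cong SE (mrenE-as-gsubE f E)
mrenE-as-gsubE f (nrecE ρ r u E) = cong₃ (nrecE ρ) (mren-as-gsub f r) (mren-as-gsub f u) (mrenE-as-gsubE f E)

mutual
  gsub-ren : ∀ σ s f t → gsub σ s (ren f t) ≡ gsub (σ ∘ f) s t
  gsub-ren σ s f (var x)        = refl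
  gsub-ren σ s f (lam ρ t)      =
    cong (lam ρ) (trans (gsub-ren (liftS σ) (liftλ s) (liftR f) t) (gsub-cong lift-comm (λ i → refl) t))
    where
    lift-comm : (liftS σ ∘ liftR f) ≗ liftS (σ ∘ f)
    lift-comm zero    = refl
    lift-comm (suc i) = refl
  gsub-ren σ s f (app t u)      = cong₂ app (gsub-ren σ s f t) (gsub-ren σ s f u)
  gsub-ren σ s f (mu ρ c)       = cong (mu ρ) (gsubC-ren (liftSμ σ) (liftμ s) f c)
  gsub-ren σ s f `0             = refl
  gsub-ren σ s f (`S t)         = cong `S (gsub-ren σ s f t)
  gsub-ren σ s f (nrec ρ r u t) = cong₃ (nrec ρ) (gsub-ren σ s f r) (gsub-ren σ s f u) (gsub-ren σ s f t)

  gsubC-ren : ∀ σ s f c → gsubC σ s (renC f c) ≡ gsubC (σ ∘ f) s c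
  gsubC-ren σ s f (named i q) = cong (λ z → named (proj₁ (s i)) (plug (proj₂ (s i)) z)) (gsub-ren σ s f q)

mutual
  gsub-mren : ∀ σ s f t → gsub σ s (mren f t) ≡ gsub σ (s ∘ f) t
  gsub-mren σ s f (var x)        = refl
  gsub-mren σ s f (lam ρ t)      = cong (lam ρ) (gsub-mren (liftS σ) (liftλ s) f t)
  gsub-mren σ s f (app t u)      = cong₂ app (gsub-mren σ s f t) (gsub-mren σ s f u)
  gsub-mren σ s f (mu ρ c)       =
    cong (mu ρ) (trans (gsubC-mren (liftSμ σ) (liftμ s) (liftR f) c) (gsubC-cong (λ i → refl) lift-comm c))
    where
    lift-comm : (liftμ s ∘ liftR f) ≗ liftμ (s ∘ f)
    lift-comm zero    = refl
    lift-comm (suc i) = refl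
  gsub-mren σ s f `0             = refl
  gsub-mren σ s f (`S t)         = cong `S (gsub-mren σ s f t)
  gsub-mren σ s f (nrec ρ r u t) = cong₃ (nrec ρ) (gsub-mren σ s f r) (gsub-mren σ s f u) (gsub-mren σ s f t)

  gsubC-mren : ∀ σ s f c → gsubC σ s (mrenC f c) ≡ gsubC σ (s ∘ f) c
  gsubC-mren σ s f (named i q) =
    cong (λ z → named (proj₁ (s (f i))) (plug (proj₂ (s (f i))) z)) (gsub-mren σ s f q)

gsubE-ren : ∀ σ s f E → gsubE σ s (renE f E) ≡ gsubE (σ ∘ f) s E
gsubE-ren σ s f hole            = refl
gsubE-ren σ s f (appE E t)      = cong₂ appE (gsubE-ren σ s f E) (gsub-ren σ s f t)
gsubE-ren σ s f (SE E)          = cong SE (gsubE-ren σ s f E)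
gsubE-ren σ s f (nrecE ρ r u E) = cong₃ (nrecE ρ) (gsub-ren σ s f r) (gsub-ren σ s f u) (gsubE-ren σ s f E)

gsubE-mren : ∀ σ s f E → gsubE σ s (mrenE f E) ≡ gsubE σ (s ∘ f) E
gsubE-mren σ s f hole            = refl
gsubE-mren σ s f (appE E t)      = cong₂ appE (gsubE-mren σ s f E) (gsub-mren σ s f t)
gsubE-mren σ s f (SE E)          = cong SE (gsubE-mren σ s f E)
gsubE-mren σ s f (nrecE ρ r u E) = cong₃ (nrecE ρ) (gsub-mren σ s f r) (gsub-mren σ s f u) (gsubE-mren σ s f E)

ren-ren : ∀ f g t → ren f (ren g t) ≡ ren (f ∘ g) t
ren-ren f g t =
  trans (ren-as-gsub f (ren g t)) (trans (gsub-ren (renλ f) idμ g t) (sym (ren-as-gsub (f ∘ g) t)))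

renE-renE : ∀ f g E → renE f (renE g E) ≡ renE (f ∘ g) E
renE-renE f g E =
  trans (renE-as-gsubE f (renE g E)) (trans (gsubE-ren (renλ f) idμ g E) (sym (renE-as-gsubE (f ∘ g) E)))

mren-mren : ∀ f g t → mren f (mren g t) ≡ mren (f ∘ g) t
mren-mren f g t =
  trans (mren-as-gsub f (mren g t)) (trans (gsub-mren var (renμ f) g t) (sym (mren-as-gsub (f ∘ g) t)))

mrenE-mrenE : ∀ f g E → mrenE f (mrenE g E) ≡ mrenE (f ∘ g) E
mrenE-mrenE f g E =
  trans (mrenE-as-gsubE f (mrenE g E)) (trans (gsubE-mren var (renμ f) g E) (sym (mrenE-as-gsubE (f ∘ g) E)))

-- λ-renamings and μ-renamings commute: both sides are gsub (renλ f) (renμ g).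
ren-mren : ∀ f g t → ren f (mren g t) ≡ mren g (ren f t)
ren-mren f g t = begin
  ren f (mren g t)             ≡⟨ ren-as-gsub f (mren g t) ⟩
  gsub (renλ f) idμ (mren g t) ≡⟨ gsub-mren (renλ f) idμ g t ⟩
  gsub (renλ f) (renμ g) t     ≡⟨ sym (gsub-ren var (renμ g) f t) ⟩
  gsub var (renμ g) (ren f t)  ≡⟨ sym (mren-as-gsub g (ren f t)) ⟩
  mren g (ren f t)             ∎
  where open ≡-Reasoning

renE-mrenE : ∀ f g E → renE f (mrenE g E) ≡ mrenE g (renE f E)
renE-mrenE f g E = begin
  renE f (mrenE g E)              ≡⟨ renE-as-gsubE f (mrenE g E) ⟩
  gsubE (renλ f) idμ (mrenE g E)  ≡⟨ gsubE-mren (renλ f) idμ g E ⟩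
  gsubE (renλ f) (renμ g) E       ≡⟨ sym (gsubE-ren var (renμ g) f E) ⟩
  gsubE var (renμ g) (renE f E)   ≡⟨ sym (mrenE-as-gsubE g (renE f E)) ⟩
  mrenE g (renE f E)              ∎
  where open ≡-Reasoning

renSS : (ℕ → ℕ) → SSub → SSub
renSS f s i = proj₁ (s i) , renE f (proj₂ (s i))

mrenSS : (ℕ → ℕ) → SSub → SSub
mrenSS f s i = f (proj₁ (s i)) , mrenE f (proj₂ (s i))

ren-plug : ∀ f E q → ren f (plug E q) ≡ plug (renE f E) (ren f q)
ren-plug f hole q            = refl
ren-plug f (appE E t) q      = cong (λ z → app z (ren f t)) (ren-plug f E q)
ren-plug f (SE E) q          = cong `S (ren-plug f E q)
ren-plug f (nrecE ρ r u E) q = cong (nrec ρ _ _) (ren-plug f E q)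

mren-plug : ∀ f E q → mren f (plug E q) ≡ plug (mrenE f E) (mren f q)
mren-plug f hole q            = refl
mren-plug f (appE E t) q      = cong (λ z → app z (mren f t)) (mren-plug f E q)
mren-plug f (SE E) q          = cong `S (mren-plug f E q)
mren-plug f (nrecE ρ r u E) q = cong (nrec ρ _ _) (mren-plug f E q)

mutual
  ren-gsub : ∀ f σ s t → ren f (gsub σ s t) ≡ gsub (ren f ∘ σ) (renSS f s) t
  ren-gsub f σ s (var x)        = refl
  ren-gsub f σ s (lam ρ t)      =
    cong (lam ρ) (trans (ren-gsub (liftR f) (liftS σ) (liftλ s) t) (gsub-cong liftS-comm liftλ-comm t))
    where
    liftS-comm : (ren (liftR f) ∘ liftS σ) ≗ liftS (ren f ∘ σ)
    liftS-comm zero    = refl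
    liftS-comm (suc i) = trans (ren-ren (liftR f) suc (σ i)) (sym (ren-ren suc f (σ i)))
    liftλ-comm : renSS (liftR f) (liftλ s) ≗ liftλ (renSS f s)
    liftλ-comm i = cong (proj₁ (s i) ,_) (trans (renE-renE (liftR f) suc _) (sym (renE-renE suc f _)))
  ren-gsub f σ s (app t u)      = cong₂ app (ren-gsub f σ s t) (ren-gsub f σ s u)
  ren-gsub f σ s (mu ρ c)       =
    cong (mu ρ) (trans (renC-gsubC f (liftSμ σ) (liftμ s) c) (gsubC-cong liftSμ-comm liftμ-comm c))
    where
    liftSμ-comm : (ren f ∘ liftSμ σ) ≗ liftSμ (ren f ∘ σ)
    liftSμ-comm i = ren-mren f suc (σ i)
    liftμ-comm : renSS f (liftμ s) ≗ liftμ (renSS f s)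
    liftμ-comm zero    = refl
    liftμ-comm (suc i) = cong (suc (proj₁ (s i)) ,_) (renE-mrenE f suc _)
  ren-gsub f σ s `0             = refl
  ren-gsub f σ s (`S t)         = cong `S (ren-gsub f σ s t)
  ren-gsub f σ s (nrec ρ r u t) = cong₃ (nrec ρ) (ren-gsub f σ s r) (ren-gsub f σ s u) (ren-gsub f σ s t)

  renC-gsubC : ∀ f σ s c → renC f (gsubC σ s c) ≡ gsubC (ren f ∘ σ) (renSS f s) c
  renC-gsubC f σ s (named i q) =
    cong (named (proj₁ (s i))) (trans (ren-plug f (proj₂ (s i)) _) (cong (plug _) (ren-gsub f σ s q)))

mutual
  mren-gsub : ∀ f σ s t → mren f (gsub σ s t) ≡ gsub (mren f ∘ σ) (mrenSS f s) t
  mren-gsub f σ s (var x)        = refl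
  mren-gsub f σ s (lam ρ t)      =
    cong (lam ρ) (trans (mren-gsub f (liftS σ) (liftλ s) t) (gsub-cong liftS-comm liftλ-comm t))
    where
    liftS-comm : (mren f ∘ liftS σ) ≗ liftS (mren f ∘ σ)
    liftS-comm zero    = refl
    liftS-comm (suc i) = sym (ren-mren suc f (σ i))
    liftλ-comm : mrenSS f (liftλ s) ≗ liftλ (mrenSS f s)
    liftλ-comm i = cong (f (proj₁ (s i)) ,_) (sym (renE-mrenE suc f _))
  mren-gsub f σ s (app t u)      = cong₂ app (mren-gsub f σ s t) (mren-gsub f σ s u)
  mren-gsub f σ s (mu ρ c)       =
    cong (mu ρ) (trans (mrenC-gsubC (liftR f) (liftSμ σ) (liftμ s) c) (gsubC-cong liftSμ-comm liftμ-comm c))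
    where
    liftSμ-comm : (mren (liftR f) ∘ liftSμ σ) ≗ liftSμ (mren f ∘ σ)
    liftSμ-comm i = trans (mren-mren (liftR f) suc (σ i)) (sym (mren-mren suc f (σ i)))
    liftμ-comm : mrenSS (liftR f) (liftμ s) ≗ liftμ (mrenSS f s)
    liftμ-comm zero    = refl
    liftμ-comm (suc i) =
      cong (suc (f (proj₁ (s i))) ,_) (trans (mrenE-mrenE (liftR f) suc _) (sym (mrenE-mrenE suc f _)))
  mren-gsub f σ s `0             = refl
  mren-gsub f σ s (`S t)         = cong `S (mren-gsub f σ s t)
  mren-gsub f σ s (nrec ρ r u t) = cong₃ (nrec ρ) (mren-gsub f σ s r) (mren-gsub f σ s u) (mren-gsub f σ s t)

  mrenC-gsubC : ∀ f σ s c → mrenC f (gsubC σ s c) ≡ gsubC (mren f ∘ σ) (mrenSS f s) c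
  mrenC-gsubC f σ s (named i q) =
    cong (named (f (proj₁ (s i)))) (trans (mren-plug f (proj₂ (s i)) _) (cong (plug _) (mren-gsub f σ s q)))

renE-gsubE : ∀ f σ s E → renE f (gsubE σ s E) ≡ gsubE (ren f ∘ σ) (renSS f s) E
renE-gsubE f σ s hole            = refl
renE-gsubE f σ s (appE E t)      = cong₂ appE (renE-gsubE f σ s E) (ren-gsub f σ s t)
renE-gsubE f σ s (SE E)          = cong SE (renE-gsubE f σ s E)
renE-gsubE f σ s (nrecE ρ r u E) = cong₃ (nrecE ρ) (ren-gsub f σ s r) (ren-gsub f σ s u) (renE-gsubE f σ s E)

mrenE-gsubE : ∀ f σ s E → mrenE f (gsubE σ s E) ≡ gsubE (mren f ∘ σ) (mrenSS f s) E
mrenE-gsubE f σ s hole            = refl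
mrenE-gsubE f σ s (appE E t)      = cong₂ appE (mrenE-gsubE f σ s E) (mren-gsub f σ s t)
mrenE-gsubE f σ s (SE E)          = cong SE (mrenE-gsubE f σ s E)
mrenE-gsubE f σ s (nrecE ρ r u E) = cong₃ (nrecE ρ) (mren-gsub f σ s r) (mren-gsub f σ s u) (mrenE-gsubE f σ s E)

renE-compE : ∀ f E F → renE f (compE E F) ≡ compE (renE f E) (renE f F)
renE-compE f hole F            = refl
renE-compE f (appE E t) F      = cong (λ z → appE z (ren f t)) (renE-compE f E F)
renE-compE f (SE E) F          = cong SE (renE-compE f E F)
renE-compE f (nrecE ρ r u E) F = cong (nrecE ρ _ _) (renE-compE f E F)

mrenE-compE : ∀ f E F → mrenE f (compE E F) ≡ compE (mrenE f E) (mrenE f F)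
mrenE-compE f hole F            = refl
mrenE-compE f (appE E t) F      = cong (λ z → appE z (mren f t)) (mrenE-compE f E F)
mrenE-compE f (SE E) F          = cong SE (mrenE-compE f E F)
mrenE-compE f (nrecE ρ r u E) F = cong (nrecE ρ _ _) (mrenE-compE f E F)

composeλ : LSub → SSub → LSub → LSub
composeλ σ₂ s₂ σ₁ x = gsub σ₂ s₂ (σ₁ x)

composeμ : LSub → SSub → SSub → SSub
composeμ σ₂ s₂ s₁ i =
  proj₁ (s₂ (proj₁ (s₁ i))) , compE (proj₂ (s₂ (proj₁ (s₁ i)))) (gsubE σ₂ s₂ (proj₂ (s₁ i)))

mutual
  gsub-gsub : ∀ σ₂ s₂ σ₁ s₁ t →
              gsub σ₂ s₂ (gsub σ₁ s₁ t) ≡ gsub (composeλ σ₂ s₂ σ₁) (composeμ σ₂ s₂ s₁) t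
  gsub-gsub σ₂ s₂ σ₁ s₁ (var x)        = refl
  gsub-gsub σ₂ s₂ σ₁ s₁ (lam ρ t)      =
    cong (lam ρ) (trans (gsub-gsub (liftS σ₂) (liftλ s₂) (liftS σ₁) (liftλ s₁) t) (gsub-cong liftS-comm liftλ-comm t))
    where
    liftS-comm : composeλ (liftS σ₂) (liftλ s₂) (liftS σ₁) ≗ liftS (composeλ σ₂ s₂ σ₁)
    liftS-comm zero    = refl
    liftS-comm (suc n) = trans (gsub-ren (liftS σ₂) (liftλ s₂) suc (σ₁ n)) (sym (ren-gsub suc σ₂ s₂ (σ₁ n)))
    liftλ-comm : composeμ (liftS σ₂) (liftλ s₂) (liftλ s₁) ≗ liftλ (composeμ σ₂ s₂ s₁)
    liftλ-comm i = cong (proj₁ (s₂ j) ,_) (trans (cong (compE (renE suc E₂)) inner) (sym (renE-compE suc E₂ _)))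
      where
      j = proj₁ (s₁ i)
      E₁ = proj₂ (s₁ i)
      E₂ = proj₂ (s₂ j)
      inner : gsubE (liftS σ₂) (liftλ s₂) (renE suc E₁) ≡ renE suc (gsubE σ₂ s₂ E₁)
      inner = trans (gsubE-ren (liftS σ₂) (liftλ s₂) suc E₁) (sym (renE-gsubE suc σ₂ s₂ E₁))
  gsub-gsub σ₂ s₂ σ₁ s₁ (app t u)      = cong₂ app (gsub-gsub σ₂ s₂ σ₁ s₁ t) (gsub-gsub σ₂ s₂ σ₁ s₁ u)
  gsub-gsub σ₂ s₂ σ₁ s₁ (mu ρ c)       =
    cong (mu ρ) (trans (gsubC-gsubC (liftSμ σ₂) (liftμ s₂) (liftSμ σ₁) (liftμ s₁) c)
                       (gsubC-cong liftSμ-comm liftμ-comm c))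
    where
    liftSμ-comm : composeλ (liftSμ σ₂) (liftμ s₂) (liftSμ σ₁) ≗ liftSμ (composeλ σ₂ s₂ σ₁)
    liftSμ-comm n = trans (gsub-mren (liftSμ σ₂) (liftμ s₂) suc (σ₁ n)) (sym (mren-gsub suc σ₂ s₂ (σ₁ n)))
    liftμ-comm : composeμ (liftSμ σ₂) (liftμ s₂) (liftμ s₁) ≗ liftμ (composeμ σ₂ s₂ s₁)
    liftμ-comm zero    = refl
    liftμ-comm (suc i) =
      cong (suc (proj₁ (s₂ j)) ,_) (trans (cong (compE (mrenE suc E₂)) inner) (sym (mrenE-compE suc E₂ _)))
      where
      j = proj₁ (s₁ i)
      E₁ = proj₂ (s₁ i)
      E₂ = proj₂ (s₂ j)
      inner : gsubE (liftSμ σ₂) (liftμ s₂) (mrenE suc E₁) ≡ mrenE suc (gsubE σ₂ s₂ E₁)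
      inner = trans (gsubE-mren (liftSμ σ₂) (liftμ s₂) suc E₁) (sym (mrenE-gsubE suc σ₂ s₂ E₁))
  gsub-gsub σ₂ s₂ σ₁ s₁ `0             = refl
  gsub-gsub σ₂ s₂ σ₁ s₁ (`S t)         = cong `S (gsub-gsub σ₂ s₂ σ₁ s₁ t)
  gsub-gsub σ₂ s₂ σ₁ s₁ (nrec ρ r u t) =
    cong₃ (nrec ρ) (gsub-gsub σ₂ s₂ σ₁ s₁ r) (gsub-gsub σ₂ s₂ σ₁ s₁ u) (gsub-gsub σ₂ s₂ σ₁ s₁ t)

  gsubC-gsubC : ∀ σ₂ s₂ σ₁ s₁ c →
                gsubC σ₂ s₂ (gsubC σ₁ s₁ c) ≡ gsubC (composeλ σ₂ s₂ σ₁) (composeμ σ₂ s₂ s₁) c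
  gsubC-gsubC σ₂ s₂ σ₁ s₁ (named i q) = cong (named _) (begin
    plug E₂ (gsub σ₂ s₂ (plug E₁ (gsub σ₁ s₁ q)))
      ≡⟨ cong (plug E₂) (gsub-plug σ₂ s₂ E₁ _) ⟩
    plug E₂ (plug (gsubE σ₂ s₂ E₁) (gsub σ₂ s₂ (gsub σ₁ s₁ q)))
      ≡⟨ sym (plug-compE E₂ _ _) ⟩
    plug (compE E₂ (gsubE σ₂ s₂ E₁)) (gsub σ₂ s₂ (gsub σ₁ s₁ q))
      ≡⟨ cong (plug _) (gsub-gsub σ₂ s₂ σ₁ s₁ q) ⟩
    plug (compE E₂ (gsubE σ₂ s₂ E₁)) (gsub (composeλ σ₂ s₂ σ₁) (composeμ σ₂ s₂ s₁) q) ∎)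
    where
    open ≡-Reasoning
    E₁ = proj₂ (s₁ i)
    E₂ = proj₂ (s₂ (proj₁ (s₁ i)))

mutual
  gsub-id : ∀ t → gsub var idμ t ≡ t
  gsub-id (var x)        = refl
  gsub-id (lam ρ t)      = cong (lam ρ) (trans (gsub-cong liftS-var liftλ-idμ t) (gsub-id t))
  gsub-id (app t u)      = cong₂ app (gsub-id t) (gsub-id u)
  gsub-id (mu ρ c)       = cong (mu ρ) (trans (gsubC-cong (λ _ → refl) liftμ-idμ c) (gsubC-id c))
  gsub-id `0             = refl
  gsub-id (`S t)         = cong `S (gsub-id t)
  gsub-id (nrec ρ r u t) = cong₃ (nrec ρ) (gsub-id r) (gsub-id u) (gsub-id t)

  gsubC-id : ∀ c → gsubC var idμ c ≡ c
  gsubC-id (named i q) = cong (named i) (gsub-id q)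

gsubE-id : ∀ E → gsubE var idμ E ≡ E
gsubE-id hole            = refl
gsubE-id (appE E t)      = cong₂ appE (gsubE-id E) (gsub-id t)
gsubE-id (SE E)          = cong SE (gsubE-id E)
gsubE-id (nrecE ρ r u E) = cong₃ (nrecE ρ) (gsub-id r) (gsub-id u) (gsubE-id E)

-- 2. Typing of contexts and substitutions; subject reduction

infix 4 _⨾_⊢E_∶_↝_
data _⨾_⊢E_∶_↝_ (Γ Δ : List Ty) : ECtx → Ty → Ty → Set where
  ⊢hole  : ∀ {ρ} → Γ ⨾ Δ ⊢E hole ∶ ρ ↝ ρ
  ⊢appE  : ∀ {E t ρ σ τ} → Γ ⨾ Δ ⊢E E ∶ ρ ↝ (σ ⇒ τ) → Γ ⨾ Δ ⊢ t ∶ σ → Γ ⨾ Δ ⊢E appE E t ∶ ρ ↝ τ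
  ⊢SE    : ∀ {E ρ} → Γ ⨾ Δ ⊢E E ∶ ρ ↝ nat → Γ ⨾ Δ ⊢E SE E ∶ ρ ↝ nat
  ⊢nrecE : ∀ {E ρ ρ' r u} → Γ ⨾ Δ ⊢E E ∶ ρ ↝ nat → Γ ⨾ Δ ⊢ r ∶ ρ' → Γ ⨾ Δ ⊢ u ∶ nat ⇒ ρ' ⇒ ρ' →
           Γ ⨾ Δ ⊢E nrecE ρ' r u E ∶ ρ ↝ ρ'

-- Shape E ρ τ : the typing of E restricted to its frames, ignoring the terms
-- they carry.  It is all that is needed to push a μ through E (push-μ below),
-- and it is preserved by renamings.
data Shape : ECtx → Ty → Ty → Set where
  shole  : ∀ {ρ} → Shape hole ρ ρ
  sappE  : ∀ {E t ρ σ τ} → Shape E ρ (σ ⇒ τ) → Shape (appE E t) ρ τ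
  sSE    : ∀ {E ρ} → Shape E ρ nat → Shape (SE E) ρ nat
  snrecE : ∀ {E ρ ρ' r u} → Shape E ρ nat → Shape (nrecE ρ' r u E) ρ ρ'

⊢E→Shape : ∀ {Γ Δ E ρ τ} → Γ ⨾ Δ ⊢E E ∶ ρ ↝ τ → Shape E ρ τ
⊢E→Shape ⊢hole          = shole
⊢E→Shape (⊢appE d x)    = sappE (⊢E→Shape d)
⊢E→Shape (⊢SE d)        = sSE (⊢E→Shape d)
⊢E→Shape (⊢nrecE d x y) = snrecE (⊢E→Shape d)

Shape-renE : ∀ {E ρ τ} f → Shape E ρ τ → Shape (renE f E) ρ τ
Shape-renE f shole      = shole
Shape-renE f (sappE d)  = sappE (Shape-renE f d)
Shape-renE f (sSE d)    = sSE (Shape-renE f d)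
Shape-renE f (snrecE d) = snrecE (Shape-renE f d)

Shape-mrenE : ∀ {E ρ τ} f → Shape E ρ τ → Shape (mrenE f E) ρ τ
Shape-mrenE f shole      = shole
Shape-mrenE f (sappE d)  = sappE (Shape-mrenE f d)
Shape-mrenE f (sSE d)    = sSE (Shape-mrenE f d)
Shape-mrenE f (snrecE d) = snrecE (Shape-mrenE f d)

⊢plug : ∀ {Γ Δ E ρ τ q} → Γ ⨾ Δ ⊢E E ∶ ρ ↝ τ → Γ ⨾ Δ ⊢ q ∶ ρ → Γ ⨾ Δ ⊢ plug E q ∶ τ
⊢plug ⊢hole d          = d
⊢plug (⊢appE e x) d    = ⊢app (⊢plug e d) x
⊢plug (⊢SE e) d        = ⊢S (⊢plug e d)
⊢plug (⊢nrecE e x y) d = ⊢nrec x y (⊢plug e d)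

⊢compE : ∀ {Γ Δ E F ρ ρ₁ τ} → Γ ⨾ Δ ⊢E E ∶ ρ₁ ↝ τ → Γ ⨾ Δ ⊢E F ∶ ρ ↝ ρ₁ → Γ ⨾ Δ ⊢E compE E F ∶ ρ ↝ τ
⊢compE ⊢hole f          = f
⊢compE (⊢appE d x) f    = ⊢appE (⊢compE d f) x
⊢compE (⊢SE d) f        = ⊢SE (⊢compE d f)
⊢compE (⊢nrecE d x y) f = ⊢nrecE (⊢compE d f) x y

⊢compE-inv : ∀ {Γ Δ} E {F ρ τ} → Γ ⨾ Δ ⊢E compE E F ∶ ρ ↝ τ →
             Σ Ty λ ρ₁ → (Γ ⨾ Δ ⊢E F ∶ ρ ↝ ρ₁) × (Γ ⨾ Δ ⊢E E ∶ ρ₁ ↝ τ)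
⊢compE-inv hole d = _ , d , ⊢hole
⊢compE-inv (appE E t) (⊢appE d x) with ⊢compE-inv E d
... | ρ₁ , tyF , tyE = ρ₁ , tyF , ⊢appE tyE x
⊢compE-inv (SE E) (⊢SE d) with ⊢compE-inv E d
... | ρ₁ , tyF , tyE = ρ₁ , tyF , ⊢SE tyE
⊢compE-inv (nrecE ρ r u E) (⊢nrecE d x y) with ⊢compE-inv E d
... | ρ₁ , tyF , tyE = ρ₁ , tyF , ⊢nrecE tyE x y

⊢num : ∀ {Γ Δ} n → Γ ⨾ Δ ⊢ num n ∶ nat
⊢num zero    = ⊢0
⊢num (suc n) = ⊢S (⊢num n)

TypedRen : (ℕ → ℕ) → List Ty → List Ty → Set
TypedRen f Γ Γ' = ∀ {x τ} → Γ ∋ x ∶ τ → Γ' ∋ f x ∶ τ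

liftR-typed : ∀ {f Γ Γ' σ} → TypedRen f Γ Γ' → TypedRen (liftR f) (σ ∷ Γ) (σ ∷ Γ')
liftR-typed h here      = here
liftR-typed h (there x) = there (h x)

mutual
  ⊢ren : ∀ {Γ Γ' Δ t ρ f} → TypedRen f Γ Γ' → Γ ⨾ Δ ⊢ t ∶ ρ → Γ' ⨾ Δ ⊢ ren f t ∶ ρ
  ⊢ren h (⊢var x)      = ⊢var (h x)
  ⊢ren h (⊢lam d)      = ⊢lam (⊢ren (liftR-typed h) d)
  ⊢ren h (⊢app d e)    = ⊢app (⊢ren h d) (⊢ren h e)
  ⊢ren h ⊢0            = ⊢0
  ⊢ren h (⊢S d)        = ⊢S (⊢ren h d)
  ⊢ren h (⊢nrec d e g) = ⊢nrec (⊢ren h d) (⊢ren h e) (⊢ren h g)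
  ⊢ren h (⊢mu c)       = ⊢mu (⊢renC h c)

  ⊢renC : ∀ {Γ Γ' Δ c f} → TypedRen f Γ Γ' → Γ ⨾ Δ ⊢ᶜ c → Γ' ⨾ Δ ⊢ᶜ renC f c
  ⊢renC h (⊢named d x) = ⊢named (⊢ren h d) x

mutual
  ⊢mren : ∀ {Γ Δ Δ' t ρ f} → TypedRen f Δ Δ' → Γ ⨾ Δ ⊢ t ∶ ρ → Γ ⨾ Δ' ⊢ mren f t ∶ ρ
  ⊢mren h (⊢var x)      = ⊢var x
  ⊢mren h (⊢lam d)      = ⊢lam (⊢mren h d)
  ⊢mren h (⊢app d e)    = ⊢app (⊢mren h d) (⊢mren h e)
  ⊢mren h ⊢0            = ⊢0
  ⊢mren h (⊢S d)        = ⊢S (⊢mren h d)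
  ⊢mren h (⊢nrec d e g) = ⊢nrec (⊢mren h d) (⊢mren h e) (⊢mren h g)
  ⊢mren h (⊢mu c)       = ⊢mu (⊢mrenC (liftR-typed h) c)

  ⊢mrenC : ∀ {Γ Δ Δ' c f} → TypedRen f Δ Δ' → Γ ⨾ Δ ⊢ᶜ c → Γ ⨾ Δ' ⊢ᶜ mrenC f c
  ⊢mrenC h (⊢named d x) = ⊢named (⊢mren h d) (h x)

⊢renE : ∀ {Γ Γ' Δ E ρ τ f} → TypedRen f Γ Γ' → Γ ⨾ Δ ⊢E E ∶ ρ ↝ τ → Γ' ⨾ Δ ⊢E renE f E ∶ ρ ↝ τ
⊢renE h ⊢hole          = ⊢hole
⊢renE h (⊢appE d x)    = ⊢appE (⊢renE h d) (⊢ren h x)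
⊢renE h (⊢SE d)        = ⊢SE (⊢renE h d)
⊢renE h (⊢nrecE d x y) = ⊢nrecE (⊢renE h d) (⊢ren h x) (⊢ren h y)

⊢mrenE : ∀ {Γ Δ Δ' E ρ τ f} → TypedRen f Δ Δ' → Γ ⨾ Δ ⊢E E ∶ ρ ↝ τ → Γ ⨾ Δ' ⊢E mrenE f E ∶ ρ ↝ τ
⊢mrenE h ⊢hole          = ⊢hole
⊢mrenE h (⊢appE d x)    = ⊢appE (⊢mrenE h d) (⊢mren h x)
⊢mrenE h (⊢SE d)        = ⊢SE (⊢mrenE h d)
⊢mrenE h (⊢nrecE d x y) = ⊢nrecE (⊢mrenE h d) (⊢mren h x) (⊢mren h y)

_⊆_ : List Ty → List Ty → Set
Γ ⊆ Γ' = ∀ {x τ} → Γ ∋ x ∶ τ → Γ' ∋ x ∶ τ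

lift⊆ : ∀ {Γ Γ' σ} → Γ ⊆ Γ' → (σ ∷ Γ) ⊆ (σ ∷ Γ')
lift⊆ h here      = here
lift⊆ h (there x) = there (h x)

⊆-++ : ∀ {Δ : List Ty} X → Δ ⊆ (Δ ++ X)
⊆-++ X here      = here
⊆-++ X (there y) = there (⊆-++ X y)

∋-++ : ∀ (Δ : List Ty) ρ → (Δ ++ (ρ ∷ [])) ∋ length Δ ∶ ρ
∋-++ [] ρ      = here
∋-++ (x ∷ Δ) ρ = there (∋-++ Δ ρ)

mutual
  ⊢mono : ∀ {Γ Γ' Δ Δ' t ρ} → Γ ⊆ Γ' → Δ ⊆ Δ' → Γ ⨾ Δ ⊢ t ∶ ρ → Γ' ⨾ Δ' ⊢ t ∶ ρ
  ⊢mono a b (⊢var x)      = ⊢var (a x)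
  ⊢mono a b (⊢lam d)      = ⊢lam (⊢mono (lift⊆ a) b d)
  ⊢mono a b (⊢app d e)    = ⊢app (⊢mono a b d) (⊢mono a b e)
  ⊢mono a b ⊢0            = ⊢0
  ⊢mono a b (⊢S d)        = ⊢S (⊢mono a b d)
  ⊢mono a b (⊢nrec d e g) = ⊢nrec (⊢mono a b d) (⊢mono a b e) (⊢mono a b g)
  ⊢mono a b (⊢mu c)       = ⊢mu (⊢monoC a (lift⊆ b) c)

  ⊢monoC : ∀ {Γ Γ' Δ Δ' c} → Γ ⊆ Γ' → Δ ⊆ Δ' → Γ ⨾ Δ ⊢ᶜ c → Γ' ⨾ Δ' ⊢ᶜ c
  ⊢monoC a b (⊢named d x) = ⊢named (⊢mono a b d) (b x)

⊢monoE : ∀ {Γ Γ' Δ Δ' E ρ τ} → Γ ⊆ Γ' → Δ ⊆ Δ' → Γ ⨾ Δ ⊢E E ∶ ρ ↝ τ → Γ' ⨾ Δ' ⊢E E ∶ ρ ↝ τ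
⊢monoE a b ⊢hole          = ⊢hole
⊢monoE a b (⊢appE d x)    = ⊢appE (⊢monoE a b d) (⊢mono a b x)
⊢monoE a b (⊢SE d)        = ⊢SE (⊢monoE a b d)
⊢monoE a b (⊢nrecE d x y) = ⊢nrecE (⊢monoE a b d) (⊢mono a b x) (⊢mono a b y)

-- Strengthening: if mren f t is typed and f reflects the typing of names,
-- then t is typed.  This types the reduct of the μη rule.

TypedStr : (ℕ → ℕ) → List Ty → List Ty → Set
TypedStr f Δ Δ' = ∀ {x τ} → Δ' ∋ f x ∶ τ → Δ ∋ x ∶ τ

liftStr : ∀ {f Δ Δ' σ} → TypedStr f Δ Δ' → TypedStr (liftR f) (σ ∷ Δ) (σ ∷ Δ')
liftStr h {zero} here      = here
liftStr h {suc x} (there y) = there (h y)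

typedStr-suc : ∀ {Δ ρ} → TypedStr suc Δ (ρ ∷ Δ)
typedStr-suc (there y) = y

mutual
  ⊢unmren : ∀ {Γ Δ Δ' t ρ f} → TypedStr f Δ Δ' → Γ ⨾ Δ' ⊢ mren f t ∶ ρ → Γ ⨾ Δ ⊢ t ∶ ρ
  ⊢unmren {t = var x} h (⊢var y) = ⊢var y
  ⊢unmren {t = lam ρ t} h (⊢lam d) = ⊢lam (⊢unmren h d)
  ⊢unmren {t = app t u} h (⊢app d e) = ⊢app (⊢unmren h d) (⊢unmren h e)
  ⊢unmren {t = mu ρ c} h (⊢mu d) = ⊢mu (⊢unmrenC (liftStr h) d)
  ⊢unmren {t = `0} h ⊢0 = ⊢0
  ⊢unmren {t = `S t} h (⊢S d) = ⊢S (⊢unmren h d)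
  ⊢unmren {t = nrec ρ r u t} h (⊢nrec d e g) = ⊢nrec (⊢unmren h d) (⊢unmren h e) (⊢unmren h g)

  ⊢unmrenC : ∀ {Γ Δ Δ' c f} → TypedStr f Δ Δ' → Γ ⨾ Δ' ⊢ᶜ mrenC f c → Γ ⨾ Δ ⊢ᶜ c
  ⊢unmrenC {c = named α t} h (⊢named d x) = ⊢named (⊢unmren h d) (h x)

TypedLSub : List Ty → List Ty → List Ty → LSub → Set
TypedLSub Γ₀ Γ Δ σ = ∀ {x ρ} → Γ₀ ∋ x ∶ ρ → Γ ⨾ Δ ⊢ σ x ∶ ρ

TypedSSub : List Ty → List Ty → List Ty → SSub → Set
TypedSSub Δ₀ Γ Δ s = ∀ {α ρ} → Δ₀ ∋ α ∶ ρ →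
  Σ Ty λ τ → (Γ ⨾ Δ ⊢E proj₂ (s α) ∶ ρ ↝ τ) × (Δ ∋ proj₁ (s α) ∶ τ)

mutual
  ⊢gsub : ∀ {Γ₀ Δ₀ Γ Δ σ s t ρ} → TypedLSub Γ₀ Γ Δ σ → TypedSSub Δ₀ Γ Δ s →
          Γ₀ ⨾ Δ₀ ⊢ t ∶ ρ → Γ ⨾ Δ ⊢ gsub σ s t ∶ ρ
  ⊢gsub hσ hs (⊢var x)              = hσ x
  ⊢gsub {σ = σ} {s} hσ hs (⊢lam d)  = ⊢lam (⊢gsub hσ' hs' d)
    where
    hσ' : TypedLSub _ _ _ (liftS σ)
    hσ' here      = ⊢var here
    hσ' (there x) = ⊢ren there (hσ x)
    hs' : TypedSSub _ _ _ (liftλ s)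
    hs' a with hs a
    ... | τ , e , b = τ , ⊢renE there e , b
  ⊢gsub hσ hs (⊢app d e)            = ⊢app (⊢gsub hσ hs d) (⊢gsub hσ hs e)
  ⊢gsub hσ hs ⊢0                    = ⊢0
  ⊢gsub hσ hs (⊢S d)                = ⊢S (⊢gsub hσ hs d)
  ⊢gsub hσ hs (⊢nrec d e g)         = ⊢nrec (⊢gsub hσ hs d) (⊢gsub hσ hs e) (⊢gsub hσ hs g)
  ⊢gsub {σ = σ} {s} hσ hs (⊢mu c)   = ⊢mu (⊢gsubC hσ' hs' c)
    where
    hσ' : TypedLSub _ _ _ (liftSμ σ)
    hσ' x = ⊢mren there (hσ x)
    hs' : TypedSSub _ _ _ (liftμ s)
    hs' here = _ , ⊢hole , here
    hs' (there a) with hs a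
    ... | τ , e , b = τ , ⊢mrenE there e , there b

  ⊢gsubC : ∀ {Γ₀ Δ₀ Γ Δ σ s c} → TypedLSub Γ₀ Γ Δ σ → TypedSSub Δ₀ Γ Δ s →
           Γ₀ ⨾ Δ₀ ⊢ᶜ c → Γ ⨾ Δ ⊢ᶜ gsubC σ s c
  ⊢gsubC hσ hs (⊢named d x) with hs x
  ... | τ , e , b = ⊢named (⊢plug e (⊢gsub hσ hs d)) b

typedLSub-var : ∀ {Γ Δ} → TypedLSub Γ Γ Δ var
typedLSub-var x = ⊢var x

typedSSub-id : ∀ {Γ Δ} → TypedSSub Δ Γ Δ idμ
typedSSub-id x = _ , ⊢hole , x

typedLSub-single : ∀ {Γ Δ r σ} → Γ ⨾ Δ ⊢ r ∶ σ → TypedLSub (σ ∷ Γ) Γ Δ (single r)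
typedLSub-single d here      = d
typedLSub-single d (there x) = ⊢var x

typedSSub-selfS : ∀ {Γ Δ F ρ ρ₁} → Γ ⨾ (ρ₁ ∷ Δ) ⊢E F ∶ ρ ↝ ρ₁ → TypedSSub (ρ ∷ Δ) Γ (ρ₁ ∷ Δ) (selfS F)
typedSSub-selfS e here      = _ , e , here
typedSSub-selfS e (there x) = _ , ⊢hole , there x

typedSSub-renameS : ∀ {Γ Δ a ρ} → Δ ∋ a ∶ ρ → TypedSSub (ρ ∷ Δ) Γ Δ (renameS a)
typedSSub-renameS x here      = _ , ⊢hole , x
typedSSub-renameS x (there y) = _ , ⊢hole , y

⊢selfC : ∀ {Γ Δ F ρ ρ₁ c} → Γ ⨾ (ρ₁ ∷ Δ) ⊢E F ∶ ρ ↝ ρ₁ → Γ ⨾ (ρ ∷ Δ) ⊢ᶜ c →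
         Γ ⨾ (ρ₁ ∷ Δ) ⊢ᶜ ssubC (selfS F) c
⊢selfC {F = F} {c = c} e d rewrite ssubC-as-gsubC (selfS F) c = ⊢gsubC typedLSub-var (typedSSub-selfS e) d

mutual
  subject-reduction : ∀ {Γ Δ t t' ρ} → Γ ⨾ Δ ⊢ t ∶ ρ → t ⟶ t' → Γ ⨾ Δ ⊢ t' ∶ ρ
  subject-reduction (⊢app (⊢lam d) e) (rootA (β {t = t} {r = r}))
    rewrite sub-as-gsub (single r) t = ⊢gsub (typedLSub-single e) typedSSub-id d
  subject-reduction (⊢S (⊢mu c)) (rootA μS)                   = ⊢mu (⊢selfC (⊢SE ⊢hole) c)
  subject-reduction (⊢app (⊢mu c) e) (rootA μapp)             = ⊢mu (⊢selfC (⊢appE ⊢hole (⊢mren there e)) c)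
  subject-reduction (⊢nrec d e g) (rootA nrec0)               = d
  subject-reduction (⊢nrec d e (⊢S g)) (rootA (nrecS n))      = ⊢app (⊢app e g) (⊢nrec d e g)
  subject-reduction (⊢nrec d e (⊢mu c)) (rootA μnrec)         =
    ⊢mu (⊢selfC (⊢nrecE ⊢hole (⊢mren there d) (⊢mren there e)) c)
  subject-reduction (⊢mu (⊢named d here)) (rootB μη)          = ⊢unmren typedStr-suc d
  subject-reduction (⊢lam d) (ξlam r)                         = ⊢lam (subject-reduction d r)
  subject-reduction (⊢app d e) (ξappL r)                      = ⊢app (subject-reduction d r) e
  subject-reduction (⊢app d e) (ξappR r)                      = ⊢app d (subject-reduction e r)
  subject-reduction (⊢mu c) (ξmu r)                           = ⊢mu (subject-reductionC c r)
  subject-reduction (⊢S d) (ξS r)                             = ⊢S (subject-reduction d r)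
  subject-reduction (⊢nrec d e g) (ξnrec₁ r)                  = ⊢nrec (subject-reduction d r) e g
  subject-reduction (⊢nrec d e g) (ξnrec₂ r)                  = ⊢nrec d (subject-reduction e r) g
  subject-reduction (⊢nrec d e g) (ξnrec₃ r)                  = ⊢nrec d e (subject-reduction g r)

  subject-reductionC : ∀ {Γ Δ c c'} → Γ ⨾ Δ ⊢ᶜ c → c ⟶ᶜ c' → Γ ⨾ Δ ⊢ᶜ c'
  subject-reductionC (⊢named (⊢mu c) x) (rootBᶜ (μren {a = a} {c = c'}))
    rewrite ssubC-as-gsubC (renameS a) c' = ⊢gsubC typedLSub-var (typedSSub-renameS x) c
  subject-reductionC (⊢named d x) (ξnamed r) = ⊢named (subject-reduction d r) x

-- 3. Commutation lemmas, all instances of the fusion law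

gsub-fuse : ∀ σ₂ s₂ σ₁ s₁ σ s t → composeλ σ₂ s₂ σ₁ ≗ σ → composeμ σ₂ s₂ s₁ ≗ s →
            gsub σ₂ s₂ (gsub σ₁ s₁ t) ≡ gsub σ s t
gsub-fuse σ₂ s₂ σ₁ s₁ σ s t h k = trans (gsub-gsub σ₂ s₂ σ₁ s₁ t) (gsub-cong h k t)

gsubC-fuse : ∀ σ₂ s₂ σ₁ s₁ σ s c → composeλ σ₂ s₂ σ₁ ≗ σ → composeμ σ₂ s₂ s₁ ≗ s →
             gsubC σ₂ s₂ (gsubC σ₁ s₁ c) ≡ gsubC σ s c
gsubC-fuse σ₂ s₂ σ₁ s₁ σ s c h k = trans (gsubC-gsubC σ₂ s₂ σ₁ s₁ c) (gsubC-cong h k c)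

ssubC-fuse : ∀ s₂ s₁ s d → composeμ var s₂ s₁ ≗ s → ssubC s₂ (ssubC s₁ d) ≡ ssubC s d
ssubC-fuse s₂ s₁ s d k = begin
  ssubC s₂ (ssubC s₁ d)        ≡⟨ cong (ssubC s₂) (ssubC-as-gsubC s₁ d) ⟩
  ssubC s₂ (gsubC var s₁ d)    ≡⟨ ssubC-as-gsubC s₂ _ ⟩
  gsubC var s₂ (gsubC var s₁ d) ≡⟨ gsubC-fuse var s₂ var s₁ var s d (λ _ → refl) k ⟩
  gsubC var s d                ≡⟨ sym (ssubC-as-gsubC s d) ⟩
  ssubC s d                    ∎
  where open ≡-Reasoning

-- It
-- generalises renameS b (the case E = □) and is what a μ-binder becomes once
-- it is plugged into E and named b.
retarget : ℕ → ECtx → SSub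
retarget b E zero    = b , E
retarget b E (suc i) = i , hole

retarget-hole : ∀ b d → ssubC (retarget b hole) d ≡ ssubC (renameS b) d
retarget-hole b d = trans (ssubC-as-gsubC _ d) (trans (gsubC-cong (λ _ → refl) same d) (sym (ssubC-as-gsubC _ d)))
  where
  same : retarget b hole ≗ renameS b
  same zero    = refl
  same (suc i) = refl

selfS-hole : ∀ d → ssubC (selfS hole) d ≡ d
selfS-hole d = trans (ssubC-as-gsubC _ d) (trans (gsubC-cong (λ _ → refl) same d) (gsubC-id d))
  where
  same : selfS hole ≗ idμ
  same zero    = refl
  same (suc i) = refl

-- Terms and contexts lifted over a new name do not see a substitution for it.

gsubE-selfS-shifted : ∀ F E → gsubE var (selfS F) (mrenE suc E) ≡ mrenE suc E
gsubE-selfS-shifted F E = trans (gsubE-mren var (selfS F) suc E) (sym (mrenE-as-gsubE suc E))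

gsubE-retarget-shifted : ∀ b E F → gsubE var (retarget b E) (mrenE suc F) ≡ F
gsubE-retarget-shifted b E F = trans (gsubE-mren var (retarget b E) suc F) (gsubE-id F)

gsub-retarget-shifted : ∀ b E t → gsub var (retarget b E) (mren suc t) ≡ t
gsub-retarget-shifted b E t = trans (gsub-mren var (retarget b E) suc t) (gsub-id t)

gsub-shiftμ : ∀ σ s u → gsub (liftSμ σ) (liftμ s) (mren suc u) ≡ mren suc (gsub σ s u)
gsub-shiftμ σ s u = trans (gsub-mren _ _ suc u) (sym (mren-gsub suc σ s u))

gsub-num : ∀ σ s n → gsub σ s (num n) ≡ num n
gsub-num σ s zero    = refl
gsub-num σ s (suc n) = cong `S (gsub-num σ s n)

-- Composing the structural substitutions created by successive μ-steps:
-- pushing a μ through F and then through E accumulates the context E ∘ F.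

selfS-after-selfS : ∀ F E d →
  ssubC (selfS F) (ssubC (selfS (mrenE suc E)) d) ≡ ssubC (selfS (compE F (mrenE suc E))) d
selfS-after-selfS F E d = ssubC-fuse (selfS F) (selfS (mrenE suc E)) _ d fused
  where
  fused : composeμ var (selfS F) (selfS (mrenE suc E)) ≗ selfS (compE F (mrenE suc E))
  fused zero    = cong (zero ,_) (cong (compE F) (gsubE-selfS-shifted F E))
  fused (suc i) = refl

renameS-after-selfS : ∀ j E d → ssubC (renameS j) (ssubC (selfS (mrenE suc E)) d) ≡ ssubC (retarget j E) d
renameS-after-selfS j E d = ssubC-fuse (renameS j) (selfS (mrenE suc E)) (retarget j E) d fused
  where
  fused : composeμ var (renameS j) (selfS (mrenE suc E)) ≗ retarget j E
  fused zero    = cong (j ,_) (trans (gsubE-mren var (renameS j) suc E) (gsubE-id E))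
  fused (suc i) = refl

retarget-after-selfS : ∀ b E F d →
  ssubC (retarget b E) (ssubC (selfS (mrenE suc F)) d) ≡ ssubC (retarget b (compE E F)) d
retarget-after-selfS b E F d = ssubC-fuse (retarget b E) (selfS (mrenE suc F)) _ d fused
  where
  fused : composeμ var (retarget b E) (selfS (mrenE suc F)) ≗ retarget b (compE E F)
  fused zero    = cong (b ,_) (cong (compE E) (gsubE-retarget-shifted b E F))
  fused (suc i) = refl

gsub-β : ∀ σ s r t →
         gsub σ s (sub (single r) t) ≡ sub (single (gsub σ s r)) (gsub (liftS σ) (liftλ s) t)
gsub-β σ s r t = begin
  gsub σ s (sub (single r) t)                  ≡⟨ cong (gsub σ s) (sub-as-gsub (single r) t) ⟩
  gsub σ s (gsub (single r) idμ t)             ≡⟨ gsub-fuse σ s (single r) idμ _ _ t same-λ same-μ ⟩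
  gsub (composeλ r' idμ (liftS σ)) (composeμ r' idμ (liftλ s)) t
                                               ≡⟨ sym (gsub-gsub r' idμ (liftS σ) (liftλ s) t) ⟩
  gsub r' idμ (gsub (liftS σ) (liftλ s) t)     ≡⟨ sym (sub-as-gsub r' (gsub (liftS σ) (liftλ s) t)) ⟩
  sub r' (gsub (liftS σ) (liftλ s) t)          ∎
  where
  open ≡-Reasoning
  r' = single (gsub σ s r)
  same-λ : composeλ σ s (single r) ≗ composeλ r' idμ (liftS σ)
  same-λ zero    = refl
  same-λ (suc n) = sym (trans (gsub-ren r' idμ suc (σ n)) (gsub-id (σ n)))
  same-μ : composeμ σ s idμ ≗ composeμ r' idμ (liftλ s)
  same-μ i = cong (proj₁ (s i) ,_)
    (trans (compE-hole _) (sym (trans (gsubE-ren r' idμ suc (proj₂ (s i))) (gsubE-id _))))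

gsubC-selfS : ∀ σ s F c →
  gsubC (liftSμ σ) (liftμ s) (ssubC (selfS F) c)
    ≡ ssubC (selfS (gsubE (liftSμ σ) (liftμ s) F)) (gsubC (liftSμ σ) (liftμ s) c)
gsubC-selfS σ s F c = begin
  gsubC σ' s' (ssubC (selfS F) c)             ≡⟨ cong (gsubC σ' s') (ssubC-as-gsubC (selfS F) c) ⟩
  gsubC σ' s' (gsubC var (selfS F) c)         ≡⟨ gsubC-fuse σ' s' var (selfS F) _ _ c same-λ same-μ ⟩
  gsubC (composeλ var (selfS F') σ') (composeμ var (selfS F') s') c
                                              ≡⟨ sym (gsubC-gsubC var (selfS F') σ' s' c) ⟩
  gsubC var (selfS F') (gsubC σ' s' c)        ≡⟨ sym (ssubC-as-gsubC (selfS F') _) ⟩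
  ssubC (selfS F') (gsubC σ' s' c)            ∎
  where
  open ≡-Reasoning
  σ' = liftSμ σ
  s' = liftμ s
  F' = gsubE σ' s' F
  same-λ : composeλ σ' s' var ≗ composeλ var (selfS F') σ'
  same-λ x = sym (trans (gsub-mren var (selfS F') suc (σ x)) (sym (mren-as-gsub suc (σ x))))
  same-μ : composeμ σ' s' (selfS F) ≗ composeμ var (selfS F') s'
  same-μ zero    = cong (zero ,_) (sym (compE-hole F'))
  same-μ (suc i) = cong (suc (proj₁ (s i)) ,_) (trans (compE-hole _) (sym (gsubE-selfS-shifted F' (proj₂ (s i)))))

gsubC-renameS : ∀ σ s a c →
  gsubC σ s (ssubC (renameS a) c) ≡ ssubC (retarget (proj₁ (s a)) (proj₂ (s a))) (gsubC (liftSμ σ) (liftμ s) c)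
gsubC-renameS σ s a c = begin
  gsubC σ s (ssubC (renameS a) c)              ≡⟨ cong (gsubC σ s) (ssubC-as-gsubC (renameS a) c) ⟩
  gsubC σ s (gsubC var (renameS a) c)          ≡⟨ gsubC-fuse σ s var (renameS a) _ _ c same-λ same-μ ⟩
  gsubC (composeλ var R (liftSμ σ)) (composeμ var R (liftμ s)) c
                                               ≡⟨ sym (gsubC-gsubC var R (liftSμ σ) (liftμ s) c) ⟩
  gsubC var R (gsubC (liftSμ σ) (liftμ s) c)   ≡⟨ sym (ssubC-as-gsubC R _) ⟩
  ssubC R (gsubC (liftSμ σ) (liftμ s) c)       ∎
  where
  open ≡-Reasoning
  R = retarget (proj₁ (s a)) (proj₂ (s a))
  same-λ : composeλ σ s var ≗ composeλ var R (liftSμ σ)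
  same-λ x = sym (gsub-retarget-shifted (proj₁ (s a)) (proj₂ (s a)) (σ x))
  same-μ : composeμ σ s (renameS a) ≗ composeμ var R (liftμ s)
  same-μ zero    = refl
  same-μ (suc i) = cong (proj₁ (s i) ,_)
    (trans (compE-hole _) (sym (gsubE-retarget-shifted (proj₁ (s a)) (proj₂ (s a)) (proj₂ (s i)))))

extμ : SSub → ℕ × ECtx → SSub
extμ s p zero    = p
extμ s p (suc i) = s i

_∷λ_ : Tm → LSub → LSub
(u ∷λ σ) zero    = u
(u ∷λ σ) (suc n) = σ n

single-gsub-liftS : ∀ σ s u t → sub (single u) (gsub (liftS σ) (liftλ s) t) ≡ gsub (u ∷λ σ) s t
single-gsub-liftS σ s u t =
  trans (sub-as-gsub (single u) (gsub (liftS σ) (liftλ s) t))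
        (gsub-fuse (single u) idμ (liftS σ) (liftλ s) (u ∷λ σ) s t same-λ same-μ)
  where
  same-λ : composeλ (single u) idμ (liftS σ) ≗ (u ∷λ σ)
  same-λ zero    = refl
  same-λ (suc n) = trans (gsub-ren (single u) idμ suc (σ n)) (gsub-id (σ n))
  same-μ : composeμ (single u) idμ (liftλ s) ≗ s
  same-μ i = cong (proj₁ (s i) ,_) (trans (gsubE-ren (single u) idμ suc (proj₂ (s i))) (gsubE-id _))

retarget-gsubC-liftμ : ∀ σ s b E c →
  ssubC (retarget b E) (gsubC (liftSμ σ) (liftμ s) c) ≡ gsubC σ (extμ s (b , E)) c
retarget-gsubC-liftμ σ s b E c =
  trans (ssubC-as-gsubC _ _) (gsubC-fuse var (retarget b E) (liftSμ σ) (liftμ s) σ (extμ s (b , E)) c same-λ same-μ)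
  where
  same-λ : composeλ var (retarget b E) (liftSμ σ) ≗ σ
  same-λ x = gsub-retarget-shifted b E (σ x)
  same-μ : composeμ var (retarget b E) (liftμ s) ≗ extμ s (b , E)
  same-μ zero    = cong (b ,_) (compE-hole E)
  same-μ (suc i) = cong (proj₁ (s i) ,_) (gsubE-retarget-shifted b E (proj₂ (s i)))

-- 4. Reduction under substitution

infix 4 _⟶*_ _⟶ᶜ*_ _⟶E_
_⟶*_ : Tm → Tm → Set
_⟶*_ = Star _⟶_

_⟶ᶜ*_ : Cmd → Cmd → Set
_⟶ᶜ*_ = Star _⟶ᶜ_

-- Non-empty reduction sequences, stored with their first step exposed (the
-- form in which they are consumed by the strong-normalisation arguments).
Plus : {A : Set} → (A → A → Set) → A → A → Set
Plus {A} R a b = Σ A λ m → R a m × Star R m b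

Plus-map : ∀ {A B : Set} {R : A → A → Set} {T : B → B → Set} (f : A → B) →
           (∀ {a b} → R a b → T (f a) (f b)) → ∀ {a b} → Plus R a b → Plus T (f a) (f b)
Plus-map f g (m , r , rs) = f m , g r , gmap f g rs

Plus→Star : ∀ {A : Set} {R : A → A → Set} {a b} → Plus R a b → Star R a b
Plus→Star (m , r , rs) = r ◅ rs

Star-step : ∀ {A : Set} {R : A → A → Set} {a b c} → Star R a b → R b c → Plus R a c
Star-step ε r        = _ , r , ε
Star-step (x ◅ xs) r = _ , x , Plus→Star (Star-step xs r)

Star-Plus : ∀ {A : Set} {R : A → A → Set} {a b c} → Star R a b → Plus R b c → Plus R a c
Star-Plus ε p        = p
Star-Plus (x ◅ xs) p = _ , x , Plus→Star (Star-Plus xs p)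

plug-⟶ : ∀ E {q q'} → q ⟶ q' → plug E q ⟶ plug E q'
plug-⟶ hole r              = r
plug-⟶ (appE E t) r        = ξappL (plug-⟶ E r)
plug-⟶ (SE E) r            = ξS (plug-⟶ E r)
plug-⟶ (nrecE ρ r' u E) r  = ξnrec₃ (plug-⟶ E r)

data _⟶E_ : ECtx → ECtx → Set where
  appE₁  : ∀ {E E' t} → E ⟶E E' → appE E t ⟶E appE E' t
  appE₂  : ∀ {E t t'} → t ⟶ t' → appE E t ⟶E appE E t'
  SE₁    : ∀ {E E'} → E ⟶E E' → SE E ⟶E SE E'
  nrecE₁ : ∀ {ρ r r' u E} → r ⟶ r' → nrecE ρ r u E ⟶E nrecE ρ r' u E
  nrecE₂ : ∀ {ρ r u u' E} → u ⟶ u' → nrecE ρ r u E ⟶E nrecE ρ r u' E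
  nrecE₃ : ∀ {ρ r u E E'} → E ⟶E E' → nrecE ρ r u E ⟶E nrecE ρ r u E'

plugE-⟶ : ∀ {E E'} q → E ⟶E E' → plug E q ⟶ plug E' q
plugE-⟶ q (appE₁ r)  = ξappL (plugE-⟶ q r)
plugE-⟶ q (appE₂ r)  = ξappR r
plugE-⟶ q (SE₁ r)    = ξS (plugE-⟶ q r)
plugE-⟶ q (nrecE₁ r) = ξnrec₁ r
plugE-⟶ q (nrecE₂ r) = ξnrec₂ r
plugE-⟶ q (nrecE₃ r) = ξnrec₃ (plugE-⟶ q r)

plug-⟶* : ∀ E {q q'} → q ⟶* q' → plug E q ⟶* plug E q'
plug-⟶* E = gmap (plug E) (plug-⟶ E)

plugE-⟶* : ∀ q {E E'} → Star _⟶E_ E E' → plug E q ⟶* plug E' q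
plugE-⟶* q = gmap (λ E → plug E q) (plugE-⟶ q)

push-μ : ∀ {E ρ τ} → Shape E ρ τ → ∀ d → plug E (mu ρ d) ⟶* mu τ (ssubC (selfS (mrenE suc E)) d)
push-μ {ρ = ρ} shole d = subst (λ z → mu ρ d ⟶* mu ρ z) (sym (selfS-hole d)) ε
push-μ {E = appE E u} {τ = τ} (sappE sh) d =
  gmap (λ z → app z u) ξappL (push-μ sh d) ◅◅
  subst (λ z → app (mu _ (ssubC (selfS (mrenE suc E)) d)) u ⟶* mu τ z)
        (selfS-after-selfS (appE hole (mren suc u)) E d) (rootA μapp ◅ ε)
push-μ {E = SE E} (sSE sh) d =
  gmap `S ξS (push-μ sh d) ◅◅
  subst (λ z → `S (mu nat (ssubC (selfS (mrenE suc E)) d)) ⟶* mu nat z)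
        (selfS-after-selfS (SE hole) E d) (rootA μS ◅ ε)
push-μ {E = nrecE ρ' r u E} (snrecE sh) d =
  gmap (nrec ρ' r u) ξnrec₃ (push-μ sh d) ◅◅
  subst (λ z → nrec ρ' r u (mu nat (ssubC (selfS (mrenE suc E)) d)) ⟶* mu ρ' z)
        (selfS-after-selfS (nrecE ρ' (mren suc r) (mren suc u) hole) E d) (rootA μnrec ◅ ε)

gsub-rootA : ∀ σ s {t t'} → t ↦A t' → gsub σ s t ⟶ gsub σ s t'
gsub-rootA σ s (β {ρ} {t} {r}) =
  subst (λ z → gsub σ s (app (lam ρ t) r) ⟶ z) (sym (gsub-β σ s r t)) (rootA β)
gsub-rootA σ s (μS {ρ} {c}) =
  subst (λ z → gsub σ s (`S (mu ρ c)) ⟶ mu ρ z) (sym (gsubC-selfS σ s (SE hole) c)) (rootA μS)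
gsub-rootA σ s (μapp {σ'} {τ} {c} {u}) =
  subst (λ z → gsub σ s (app (mu (σ' ⇒ τ) c) u) ⟶ mu τ z) (sym commute) (rootA μapp)
  where
  commute = trans (gsubC-selfS σ s (appE hole (mren suc u)) c)
                  (cong (λ z → ssubC (selfS (appE hole z)) _) (gsub-shiftμ σ s u))
gsub-rootA σ s nrec0 = rootA nrec0
gsub-rootA σ s (nrecS {ρ} {r} {u} n) rewrite gsub-num σ s n = rootA (nrecS n)
gsub-rootA σ s (μnrec {ρ} {σ'} {r} {u} {c}) =
  subst (λ z → gsub σ s (nrec ρ r u (mu σ' c)) ⟶ mu ρ z) (sym commute) (rootA μnrec)
  where
  commute = trans (gsubC-selfS σ s (nrecE ρ (mren suc r) (mren suc u) hole) c)
                  (cong₂ (λ z w → ssubC (selfS (nrecE ρ z w hole)) _) (gsub-shiftμ σ s r) (gsub-shiftμ σ s u))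

gsub-μη : ∀ σ s {ρ t} → gsub σ s (mu ρ (named zero (mren suc t))) ⟶ gsub σ s t
gsub-μη σ s {ρ} {t} rewrite gsub-shiftμ σ s t = rootB μη

-- A μ-renaming step [a]μβ.c ⟶ c[β := a □] is preserved by gsub σ s in two
-- situations: when s has empty contexts (it is then again a μ-renaming step),
-- or when the context E = s a has a shape matching the type of β (the image
-- first pushes μβ through E, then renames).

HoleFree : SSub → Set
HoleFree s = ∀ i → proj₂ (s i) ≡ hole

HoleFree-liftλ : ∀ s → HoleFree s → HoleFree (liftλ s)
HoleFree-liftλ s h i rewrite h i = refl

HoleFree-liftμ : ∀ s → HoleFree s → HoleFree (liftμ s)
HoleFree-liftμ s h zero = refl
HoleFree-liftμ s h (suc i) rewrite h i = refl

Shaped : List Ty → SSub → Set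
Shaped Δ₀ s = ∀ {α ρ} → Δ₀ ∋ α ∶ ρ → Σ Ty λ τ → Shape (proj₂ (s α)) ρ τ

Shaped-liftλ : ∀ {Δ₀} s → Shaped Δ₀ s → Shaped Δ₀ (liftλ s)
Shaped-liftλ s h a with h a
... | τ , sh = τ , Shape-renE suc sh

Shaped-liftμ : ∀ {Δ₀ ρ} s → Shaped Δ₀ s → Shaped (ρ ∷ Δ₀) (liftμ s)
Shaped-liftμ s h here = _ , shole
Shaped-liftμ s h (there a) with h a
... | τ , sh = τ , Shape-mrenE suc sh

mutual
  gsub-⟶-holefree : ∀ σ s → HoleFree s → ∀ {t t'} → t ⟶ t' → Plus _⟶_ (gsub σ s t) (gsub σ s t')
  gsub-⟶-holefree σ s h (rootA r)              = _ , gsub-rootA σ s r , ε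
  gsub-⟶-holefree σ s h (rootB (μη {ρ} {t}))   = _ , gsub-μη σ s {ρ} {t} , ε
  gsub-⟶-holefree σ s h (ξlam {ρ} r)           =
    Plus-map (lam ρ) ξlam (gsub-⟶-holefree (liftS σ) (liftλ s) (HoleFree-liftλ s h) r)
  gsub-⟶-holefree σ s h (ξappL r)              = Plus-map (λ z → app z _) ξappL (gsub-⟶-holefree σ s h r)
  gsub-⟶-holefree σ s h (ξappR r)              = Plus-map (app _) ξappR (gsub-⟶-holefree σ s h r)
  gsub-⟶-holefree σ s h (ξmu r)                =
    Plus-map (mu _) ξmu (gsubC-⟶-holefree (liftSμ σ) (liftμ s) (HoleFree-liftμ s h) r)
  gsub-⟶-holefree σ s h (ξS r)                 = Plus-map `S ξS (gsub-⟶-holefree σ s h r)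
  gsub-⟶-holefree σ s h (ξnrec₁ r)             = Plus-map (λ z → nrec _ z _ _) ξnrec₁ (gsub-⟶-holefree σ s h r)
  gsub-⟶-holefree σ s h (ξnrec₂ r)             = Plus-map (λ z → nrec _ _ z _) ξnrec₂ (gsub-⟶-holefree σ s h r)
  gsub-⟶-holefree σ s h (ξnrec₃ r)             = Plus-map (nrec _ _ _) ξnrec₃ (gsub-⟶-holefree σ s h r)

  gsubC-⟶-holefree : ∀ σ s → HoleFree s → ∀ {c c'} → c ⟶ᶜ c' → Plus _⟶ᶜ_ (gsubC σ s c) (gsubC σ s c')
  gsubC-⟶-holefree σ s h (rootBᶜ (μren {a} {ρ} {c})) = _ , renaming-step , ε
    where
    renaming-step : gsubC σ s (named a (mu ρ c)) ⟶ᶜ gsubC σ s (ssubC (renameS a) c)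
    renaming-step rewrite h a | gsubC-renameS σ s a c | h a
                        | retarget-hole (proj₁ (s a)) (gsubC (liftSμ σ) (liftμ s) c) = rootBᶜ μren
  gsubC-⟶-holefree σ s h (ξnamed {α} r) =
    Plus-map (λ z → named (proj₁ (s α)) (plug (proj₂ (s α)) z)) (λ x → ξnamed (plug-⟶ _ x)) (gsub-⟶-holefree σ s h r)

mutual
  gsub-⟶-shaped : ∀ {Γ₀ Δ₀ t ρ} σ s → Γ₀ ⨾ Δ₀ ⊢ t ∶ ρ → Shaped Δ₀ s →
                  ∀ {t'} → t ⟶ t' → Plus _⟶_ (gsub σ s t) (gsub σ s t')
  gsub-⟶-shaped σ s d h (rootA r)                  = _ , gsub-rootA σ s r , ε
  gsub-⟶-shaped σ s d h (rootB (μη {ρ} {t}))       = _ , gsub-μη σ s {ρ} {t} , ε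
  gsub-⟶-shaped σ s (⊢lam d) h (ξlam {ρ} r)        =
    Plus-map (lam ρ) ξlam (gsub-⟶-shaped (liftS σ) (liftλ s) d (Shaped-liftλ s h) r)
  gsub-⟶-shaped σ s (⊢app d e) h (ξappL r)         = Plus-map (λ z → app z _) ξappL (gsub-⟶-shaped σ s d h r)
  gsub-⟶-shaped σ s (⊢app d e) h (ξappR r)         = Plus-map (app _) ξappR (gsub-⟶-shaped σ s e h r)
  gsub-⟶-shaped σ s (⊢mu d) h (ξmu r)              =
    Plus-map (mu _) ξmu (gsubC-⟶-shaped (liftSμ σ) (liftμ s) d (Shaped-liftμ s h) r)
  gsub-⟶-shaped σ s (⊢S d) h (ξS r)                = Plus-map `S ξS (gsub-⟶-shaped σ s d h r)
  gsub-⟶-shaped σ s (⊢nrec d e g) h (ξnrec₁ r)     = Plus-map (λ z → nrec _ z _ _) ξnrec₁ (gsub-⟶-shaped σ s d h r)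
  gsub-⟶-shaped σ s (⊢nrec d e g) h (ξnrec₂ r)     = Plus-map (λ z → nrec _ _ z _) ξnrec₂ (gsub-⟶-shaped σ s e h r)
  gsub-⟶-shaped σ s (⊢nrec d e g) h (ξnrec₃ r)     = Plus-map (nrec _ _ _) ξnrec₃ (gsub-⟶-shaped σ s g h r)

  gsubC-⟶-shaped : ∀ {Γ₀ Δ₀ c} σ s → Γ₀ ⨾ Δ₀ ⊢ᶜ c → Shaped Δ₀ s →
                   ∀ {c'} → c ⟶ᶜ c' → Plus _⟶ᶜ_ (gsubC σ s c) (gsubC σ s c')
  gsubC-⟶-shaped σ s (⊢named (⊢mu _) x) h (rootBᶜ (μren {a} {ρ} {c})) with h x
  ... | τ , sh = subst (Plus _⟶ᶜ_ (gsubC σ s (named a (mu ρ c)))) same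
                   (Star-step (gmap (named (proj₁ (s a))) ξnamed (push-μ sh d)) (rootBᶜ μren))
    where
    d = gsubC (liftSμ σ) (liftμ s) c
    same : ssubC (renameS (proj₁ (s a))) (ssubC (selfS (mrenE suc (proj₂ (s a)))) d) ≡ gsubC σ s (ssubC (renameS a) c)
    same = trans (renameS-after-selfS (proj₁ (s a)) (proj₂ (s a)) d) (sym (gsubC-renameS σ s a c))
  gsubC-⟶-shaped σ s (⊢named d x) h (ξnamed {α} r) =
    Plus-map (λ z → named (proj₁ (s α)) (plug (proj₂ (s α)) z)) (λ y → ξnamed (plug-⟶ _ y)) (gsub-⟶-shaped σ s d h r)

SSubRed : SSub → SSub → Set
SSubRed s s' = ∀ i → (proj₁ (s i) ≡ proj₁ (s' i)) × Star _⟶E_ (proj₂ (s i)) (proj₂ (s' i))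

gsubE-⟶-holefree : ∀ σ s → HoleFree s → ∀ {E E'} → E ⟶E E' → Star _⟶E_ (gsubE σ s E) (gsubE σ s E')
gsubE-⟶-holefree σ s h (appE₁ r)  = gmap (λ z → appE z _) appE₁ (gsubE-⟶-holefree σ s h r)
gsubE-⟶-holefree σ s h (appE₂ r)  = gmap (appE _) appE₂ (Plus→Star (gsub-⟶-holefree σ s h r))
gsubE-⟶-holefree σ s h (SE₁ r)    = gmap SE SE₁ (gsubE-⟶-holefree σ s h r)
gsubE-⟶-holefree σ s h (nrecE₁ r) = gmap (λ z → nrecE _ z _ _) nrecE₁ (Plus→Star (gsub-⟶-holefree σ s h r))
gsubE-⟶-holefree σ s h (nrecE₂ r) = gmap (λ z → nrecE _ _ z _) nrecE₂ (Plus→Star (gsub-⟶-holefree σ s h r))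
gsubE-⟶-holefree σ s h (nrecE₃ r) = gmap (nrecE _ _ _) nrecE₃ (gsubE-⟶-holefree σ s h r)

renE-⟶* : ∀ f {E E'} → Star _⟶E_ E E' → Star _⟶E_ (renE f E) (renE f E')
renE-⟶* f = kleisliStar (renE f) λ {a} {b} r →
  subst₂ (Star _⟶E_) (sym (renE-as-gsubE f a)) (sym (renE-as-gsubE f b))
         (gsubE-⟶-holefree (renλ f) idμ (λ _ → refl) r)

mrenE-⟶* : ∀ f {E E'} → Star _⟶E_ E E' → Star _⟶E_ (mrenE f E) (mrenE f E')
mrenE-⟶* f = kleisliStar (mrenE f) λ {a} {b} r →
  subst₂ (Star _⟶E_) (sym (mrenE-as-gsubE f a)) (sym (mrenE-as-gsubE f b))
         (gsubE-⟶-holefree var (renμ f) (λ _ → refl) r)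

SSubRed-liftλ : ∀ s s' → SSubRed s s' → SSubRed (liftλ s) (liftλ s')
SSubRed-liftλ s s' h i = proj₁ (h i) , renE-⟶* suc (proj₂ (h i))

SSubRed-liftμ : ∀ s s' → SSubRed s s' → SSubRed (liftμ s) (liftμ s')
SSubRed-liftμ s s' h zero    = refl , ε
SSubRed-liftμ s s' h (suc i) = cong suc (proj₁ (h i)) , mrenE-⟶* suc (proj₂ (h i))

mutual
  gsub-mono : ∀ σ s s' → SSubRed s s' → ∀ t → gsub σ s t ⟶* gsub σ s' t
  gsub-mono σ s s' h (var x)        = ε
  gsub-mono σ s s' h (lam ρ t)      =
    gmap (lam ρ) ξlam (gsub-mono (liftS σ) (liftλ s) (liftλ s') (SSubRed-liftλ s s' h) t)
  gsub-mono σ s s' h (app t u)      =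
    gmap (λ z → app z _) ξappL (gsub-mono σ s s' h t) ◅◅ gmap (app _) ξappR (gsub-mono σ s s' h u)
  gsub-mono σ s s' h (mu ρ c)       =
    gmap (mu ρ) ξmu (gsubC-mono (liftSμ σ) (liftμ s) (liftμ s') (SSubRed-liftμ s s' h) c)
  gsub-mono σ s s' h `0             = ε
  gsub-mono σ s s' h (`S t)         = gmap `S ξS (gsub-mono σ s s' h t)
  gsub-mono σ s s' h (nrec ρ r u t) =
    gmap (λ z → nrec ρ z _ _) ξnrec₁ (gsub-mono σ s s' h r) ◅◅
    gmap (λ z → nrec ρ _ z _) ξnrec₂ (gsub-mono σ s s' h u) ◅◅
    gmap (nrec ρ _ _) ξnrec₃ (gsub-mono σ s s' h t)

  gsubC-mono : ∀ σ s s' → SSubRed s s' → ∀ c → gsubC σ s c ⟶ᶜ* gsubC σ s' c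
  gsubC-mono σ s s' h (named i q) with h i
  ... | same-target , context-steps rewrite same-target =
    gmap (named _) ξnamed (plug-⟶* (proj₂ (s i)) (gsub-mono σ s s' h q)) ◅◅
    gmap (named _) ξnamed (plugE-⟶* (gsub σ s' q) context-steps)

-- 5. Inversion of the steps out of E[q]

S-injective : ∀ {t u} → `S t ≡ `S u → t ≡ u
S-injective refl = refl

num-injective : ∀ {m n} → num m ≡ num n → m ≡ n
num-injective {zero} {zero} e       = refl
num-injective {zero} {suc n} ()
num-injective {suc m} {zero} ()
num-injective {suc m} {suc n} e     = cong suc (num-injective (S-injective e))

mu≢num : ∀ n {ρ c} → mu ρ c ≡ num n → ⊥
mu≢num zero ()
mu≢num (suc n) ()

num-normal : ∀ n {X} → num n ⟶ X → ⊥
num-normal zero (rootA ())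
num-normal zero (rootB ())
num-normal (suc zero) (rootA ())
num-normal (suc (suc n)) (rootA ())
num-normal (suc n) (rootB ())
num-normal (suc n) (ξS r) = num-normal n r

var-normal : ∀ {x X} → var x ⟶ X → ⊥
var-normal (rootA ())
var-normal (rootB ())

lam-⟶-inv : ∀ {ρ t X} → lam ρ t ⟶ X → Σ Tm λ t' → (t ⟶ t') × (X ≡ lam ρ t')
lam-⟶-inv (rootA ())
lam-⟶-inv (rootB ())
lam-⟶-inv (ξlam r) = _ , r , refl

-- A λ-abstraction, a μ-abstraction or a numeral of the form E[q] has its
-- head in q: every frame of E is an elimination.

plug-lam : ∀ E {q ρ t} → lam ρ t ≡ plug E q → q ≡ lam ρ t
plug-lam hole e = sym e
plug-lam (appE E x) ()
plug-lam (SE E) ()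
plug-lam (nrecE ρ r u E) ()

plug-mu : ∀ E {q ρ c} → mu ρ c ≡ plug E q → (E ≡ hole) × (q ≡ mu ρ c)
plug-mu hole e = refl , sym e
plug-mu (appE E x) ()
plug-mu (SE E) ()
plug-mu (nrecE ρ r u E) ()

plug-num : ∀ n E {q} → num n ≡ plug E q → Σ ℕ λ m → q ≡ num m
plug-num n hole e                   = n , sym e
plug-num (suc n) (SE E) e           = plug-num n E (S-injective e)
plug-num zero (appE E x) ()
plug-num zero (SE E) ()
plug-num zero (nrecE ρ r u E) ()
plug-num (suc n) (appE E x) ()
plug-num (suc n) (nrecE ρ r u E) ()

-- Inert terms (variables, applications, recursors) are not values, so no
-- root step of E[q] involves both E and q.
data Inert : Tm → Set where
  ivar  : ∀ {x} → Inert (var x)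
  iapp  : ∀ {t u} → Inert (app t u)
  inrec : ∀ {ρ r u t} → Inert (nrec ρ r u t)

inert-not-lam : ∀ E {q ρ t} → Inert q → lam ρ t ≡ plug E q → ⊥
inert-not-lam E i e with plug-lam E e
inert-not-lam E () e | refl

inert-not-mu : ∀ E {q ρ c} → Inert q → mu ρ c ≡ plug E q → ⊥
inert-not-mu E i e with plug-mu E e
inert-not-mu E () e | refl , refl

inert-not-num : ∀ n E {q} → Inert q → num n ≡ plug E q → ⊥
inert-not-num n E i e with plug-num n E e
... | m , refl = not-num m i
  where
  not-num : ∀ m → Inert (num m) → ⊥
  not-num zero ()
  not-num (suc m) ()

InertRes : ECtx → Tm → Tm → Set
InertRes E q X = (Σ ECtx λ E' → E ⟶E E' × X ≡ plug E' q) ⊎ (Σ Tm λ q' → q ⟶ q' × X ≡ plug E q')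

inert-plug-inv : ∀ E {q X} → Inert q → plug E q ⟶ X → InertRes E q X
inert-plug-inv hole i r = inj₂ (_ , r , refl)
inert-plug-inv (appE E t) {q} i r = step refl r
  where
  step : ∀ {Y X} → Y ≡ plug E q → app Y t ⟶ X → InertRes (appE E t) q X
  step e (rootA β)     = ⊥-elim (inert-not-lam E i e)
  step e (rootA μapp)  = ⊥-elim (inert-not-mu E i e)
  step refl (ξappL r) with inert-plug-inv E i r
  ... | inj₁ (E' , rr , refl) = inj₁ (_ , appE₁ rr , refl)
  ... | inj₂ (q' , rr , refl) = inj₂ (q' , rr , refl)
  step refl (ξappR r)  = inj₁ (_ , appE₂ r , refl)
inert-plug-inv (SE E) {q} i r = step refl r
  where
  step : ∀ {Y X} → Y ≡ plug E q → `S Y ⟶ X → InertRes (SE E) q X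
  step e (rootA μS) = ⊥-elim (inert-not-mu E i e)
  step refl (ξS r) with inert-plug-inv E i r
  ... | inj₁ (E' , rr , refl) = inj₁ (_ , SE₁ rr , refl)
  ... | inj₂ (q' , rr , refl) = inj₂ (q' , rr , refl)
inert-plug-inv (nrecE ρ r₀ u E) {q} i r = step refl r
  where
  step : ∀ {Y X} → Y ≡ plug E q → nrec ρ r₀ u Y ⟶ X → InertRes (nrecE ρ r₀ u E) q X
  step e (rootA nrec0)      = ⊥-elim (inert-not-num zero E i e)
  step e (rootA (nrecS n))  = ⊥-elim (inert-not-num (suc n) E i e)
  step e (rootA μnrec)      = ⊥-elim (inert-not-mu E i e)
  step refl (ξnrec₁ r)      = inj₁ (_ , nrecE₁ r , refl)
  step refl (ξnrec₂ r)      = inj₁ (_ , nrecE₂ r , refl)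
  step refl (ξnrec₃ r) with inert-plug-inv E i r
  ... | inj₁ (E' , rr , refl) = inj₁ (_ , nrecE₃ rr , refl)
  ... | inj₂ (q' , rr , refl) = inj₂ (q' , rr , refl)

-- The single frames that a μ can absorb, with the binder type after the
-- step (μapp and μnrec change it).
data Frame : ECtx → Ty → Ty → Set where
  fa-app  : ∀ {u σ τ} → Frame (appE hole u) (σ ⇒ τ) τ
  fa-S    : ∀ {ρ} → Frame (SE hole) ρ ρ
  fa-nrec : ∀ {ρ' r u σ} → Frame (nrecE ρ' r u hole) σ ρ'

data MuRes (E : ECtx) (ρ : Ty) (d : Cmd) (X : Tm) : Set where
  mr-ctx  : ∀ {E'} → E ⟶E E' → X ≡ plug E' (mu ρ d) → MuRes E ρ d X
  mr-body : ∀ {d'} → d ⟶ᶜ d' → X ≡ plug E (mu ρ d') → MuRes E ρ d X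
  mr-eta  : ∀ {t} → d ≡ named zero (mren suc t) → X ≡ plug E t → MuRes E ρ d X
  mr-int  : ∀ {E₁ F ρ₁} → E ≡ compE E₁ F → Frame F ρ ρ₁ →
            X ≡ plug E₁ (mu ρ₁ (ssubC (selfS (mrenE suc F)) d)) → MuRes E ρ d X

mu-not-lam : ∀ E {ρ d ρ' t} → lam ρ' t ≡ plug E (mu ρ d) → ⊥
mu-not-lam E e with plug-lam E e
... | ()

mu-not-num : ∀ n E {ρ d} → num n ≡ plug E (mu ρ d) → ⊥
mu-not-num n E e with plug-num n E e
... | m , e' = mu≢num m e'

MuRes-frame : ∀ {E ρ d X} (G : ECtx → ECtx) (g : Tm → Tm) →
              (∀ F q → plug (G F) q ≡ g (plug F q)) → (∀ {E E'} → E ⟶E E' → G E ⟶E G E') →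
              (∀ E₁ F → G (compE E₁ F) ≡ compE (G E₁) F) →
              MuRes E ρ d X → MuRes (G E) ρ d (g X)
MuRes-frame G g plugG stepG compG (mr-ctx x refl)      = mr-ctx (stepG x) (sym (plugG _ _))
MuRes-frame G g plugG stepG compG (mr-body x refl)     = mr-body x (sym (plugG _ _))
MuRes-frame G g plugG stepG compG (mr-eta x refl)      = mr-eta x (sym (plugG _ _))
MuRes-frame G g plugG stepG compG (mr-int refl f refl) = mr-int (compG _ _) f (sym (plugG _ _))

mu-plug-inv : ∀ E {ρ d X} → plug E (mu ρ d) ⟶ X → MuRes E ρ d X
mu-plug-inv hole (rootB μη) = mr-eta refl refl
mu-plug-inv hole (ξmu r)    = mr-body r refl
mu-plug-inv (appE E t) {ρ} {d} r = step refl r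
  where
  step : ∀ {Y X} → Y ≡ plug E (mu ρ d) → app Y t ⟶ X → MuRes (appE E t) ρ d X
  step e (rootA β) = ⊥-elim (mu-not-lam E e)
  step e (rootA μapp) with plug-mu E e
  ... | refl , refl = mr-int refl fa-app refl
  step refl (ξappL r) =
    MuRes-frame (λ F → appE F t) (λ z → app z t) (λ F q → refl) appE₁ (λ E₁ F → refl) (mu-plug-inv E r)
  step refl (ξappR r) = mr-ctx (appE₂ r) refl
mu-plug-inv (SE E) {ρ} {d} r = step refl r
  where
  step : ∀ {Y X} → Y ≡ plug E (mu ρ d) → `S Y ⟶ X → MuRes (SE E) ρ d X
  step e (rootA μS) with plug-mu E e
  ... | refl , refl = mr-int refl fa-S refl
  step refl (ξS r) = MuRes-frame SE `S (λ F q → refl) SE₁ (λ E₁ F → refl) (mu-plug-inv E r)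
mu-plug-inv (nrecE ρ' r₀ u E) {ρ} {d} r = step refl r
  where
  step : ∀ {Y X} → Y ≡ plug E (mu ρ d) → nrec ρ' r₀ u Y ⟶ X → MuRes (nrecE ρ' r₀ u E) ρ d X
  step e (rootA nrec0)     = ⊥-elim (mu-not-num zero E e)
  step e (rootA (nrecS n)) = ⊥-elim (mu-not-num (suc n) E e)
  step e (rootA μnrec) with plug-mu E e
  ... | refl , refl = mr-int refl fa-nrec refl
  step refl (ξnrec₁ r) = mr-ctx (nrecE₁ r) refl
  step refl (ξnrec₂ r) = mr-ctx (nrecE₂ r) refl
  step refl (ξnrec₃ r) =
    MuRes-frame (nrecE ρ' r₀ u) (nrec ρ' r₀ u) (λ F q → refl) nrecE₃ (λ E₁ F → refl) (mu-plug-inv E r)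

-- 6. Strong normalisation of commands and contexts

data SNC (c : Cmd) : Set where
  snc : (∀ {c'} → c ⟶ᶜ c' → SNC c') → SNC c

data SNE (E : ECtx) : Set where
  sne : (∀ {E'} → E ⟶E E' → SNE E') → SNE E

snc-⟶ : ∀ {c c'} → SNC c → c ⟶ᶜ c' → SNC c'
snc-⟶ (snc f) r = f r

snc-⟶* : ∀ {c c'} → SNC c → c ⟶ᶜ* c' → SNC c'
snc-⟶* h ε        = h
snc-⟶* h (r ◅ rs) = snc-⟶* (snc-⟶ h r) rs

snc→sn : ∀ {b t} → SNC (named b t) → SN-AB t
snc→sn (snc f) = sn (λ r → snc→sn (f (ξnamed r)))

sn-plug→sne : ∀ {E} q → SN-AB (plug E q) → SNE E
sn-plug→sne q (sn f) = sne (λ r → sn-plug→sne q (f (plugE-⟶ q r)))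

-- Strong normalisation is reflected by hole-free gsub: since each step of t
-- gives a non-empty reduction of gsub σ s t, an infinite reduction of t
-- would give one of gsub σ s t.
sn-gsub-inv* : ∀ σ s → HoleFree s → ∀ {u} → SN-AB u → ∀ {t} → u ⟶* gsub σ s t → SN-AB t
sn-gsub-inv* σ s h {u} (sn f) rs = sn λ r → first-step rs (gsub-⟶-holefree σ s h r)
  where
  first-step : ∀ {v w} → u ⟶* v → Plus _⟶_ v (gsub σ s w) → SN-AB w
  first-step ε (m , x , xs)        = sn-gsub-inv* σ s h (f x) xs
  first-step (y ◅ ys) (m , x , xs) = sn-gsub-inv* σ s h (f y) (ys ◅◅ (x ◅ xs))

sn-gsub-inv : ∀ σ s → HoleFree s → ∀ {t} → SN-AB (gsub σ s t) → SN-AB t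
sn-gsub-inv σ s h a = sn-gsub-inv* σ s h a ε

sne-hole : SNE hole
sne-hole = sne (λ ())

compE-⟶-inv : ∀ E {F X} → compE E F ⟶E X →
  (Σ ECtx λ E' → E ⟶E E' × X ≡ compE E' F) ⊎ (Σ ECtx λ F' → F ⟶E F' × X ≡ compE E F')
compE-⟶-inv hole r = inj₂ (_ , r , refl)
compE-⟶-inv (appE E t) (appE₁ r) with compE-⟶-inv E r
... | inj₁ (E' , x , refl) = inj₁ (_ , appE₁ x , refl)
... | inj₂ (F' , x , refl) = inj₂ (_ , x , refl)
compE-⟶-inv (appE E t) (appE₂ r) = inj₁ (_ , appE₂ r , refl)
compE-⟶-inv (SE E) (SE₁ r) with compE-⟶-inv E r
... | inj₁ (E' , x , refl) = inj₁ (_ , SE₁ x , refl)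
... | inj₂ (F' , x , refl) = inj₂ (_ , x , refl)
compE-⟶-inv (nrecE ρ r₀ u E) (nrecE₁ r) = inj₁ (_ , nrecE₁ r , refl)
compE-⟶-inv (nrecE ρ r₀ u E) (nrecE₂ r) = inj₁ (_ , nrecE₂ r , refl)
compE-⟶-inv (nrecE ρ r₀ u E) (nrecE₃ r) with compE-⟶-inv E r
... | inj₁ (E' , x , refl) = inj₁ (_ , nrecE₃ x , refl)
... | inj₂ (F' , x , refl) = inj₂ (_ , x , refl)

compE-⟶ˡ : ∀ {E E'} F → E ⟶E E' → compE E F ⟶E compE E' F
compE-⟶ˡ F (appE₁ r)  = appE₁ (compE-⟶ˡ F r)
compE-⟶ˡ F (appE₂ r)  = appE₂ r
compE-⟶ˡ F (SE₁ r)    = SE₁ (compE-⟶ˡ F r)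
compE-⟶ˡ F (nrecE₁ r) = nrecE₁ r
compE-⟶ˡ F (nrecE₂ r) = nrecE₂ r
compE-⟶ˡ F (nrecE₃ r) = nrecE₃ (compE-⟶ˡ F r)

sne-compEˡ : ∀ {E} F → SNE (compE E F) → SNE E
sne-compEˡ F (sne f) = sne (λ r → sne-compEˡ F (f (compE-⟶ˡ F r)))

sne-compE : ∀ {E F} → SNE E → SNE F → SNE (compE E F)
sne-compE {E} {F} (sne f) (sne g) = sne step
  where
  step : ∀ {X} → compE E F ⟶E X → SNE X
  step r with compE-⟶-inv E r
  ... | inj₁ (E' , x , refl) = sne-compE (f x) (sne g)
  ... | inj₂ (F' , x , refl) = sne-compE (sne f) (g x)

sne-app : ∀ {u} → SN-AB u → SNE (appE hole u)
sne-app (sn f) = sne λ { (appE₂ r) → sne-app (f r) }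

-- The depth of a context (number of frames), the second measure of the μ case.

depth : ECtx → ℕ
depth hole            = zero
depth (appE E t)      = suc (depth E)
depth (SE E)          = suc (depth E)
depth (nrecE ρ r u E) = suc (depth E)

depth-compE-frame : ∀ E {F ρ ρ₁} → Frame F ρ ρ₁ → depth (compE E F) ≡ suc (depth E)
depth-compE-frame hole fa-app          = refl
depth-compE-frame hole fa-S            = refl
depth-compE-frame hole fa-nrec         = refl
depth-compE-frame (appE E x) f         = cong suc (depth-compE-frame E f)
depth-compE-frame (SE E) f             = cong suc (depth-compE-frame E f)
depth-compE-frame (nrecE ρ r u E) f    = cong suc (depth-compE-frame E f)

depth-⟶E : ∀ {E E'} → E ⟶E E' → depth E' ≡ depth E
depth-⟶E (appE₁ r)  = cong suc (depth-⟶E r)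
depth-⟶E (appE₂ r)  = refl
depth-⟶E (SE₁ r)    = cong suc (depth-⟶E r)
depth-⟶E (nrecE₁ r) = refl
depth-⟶E (nrecE₂ r) = refl
depth-⟶E (nrecE₃ r) = cong suc (depth-⟶E r)

Frame-type : ∀ {Γ Δ F ρ ρ₁ ρ₂} → Frame F ρ ρ₁ → Γ ⨾ Δ ⊢E F ∶ ρ ↝ ρ₂ → ρ₂ ≡ ρ₁
Frame-type fa-app (⊢appE ⊢hole x)       = refl
Frame-type fa-S (⊢SE ⊢hole)             = refl
Frame-type fa-nrec (⊢nrecE ⊢hole x y)   = refl

subject-reductionE : ∀ {Γ Δ E E' ρ τ} → Γ ⨾ Δ ⊢E E ∶ ρ ↝ τ → E ⟶E E' → Γ ⨾ Δ ⊢E E' ∶ ρ ↝ τ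
subject-reductionE (⊢appE d x) (appE₁ r)    = ⊢appE (subject-reductionE d r) x
subject-reductionE (⊢appE d x) (appE₂ r)    = ⊢appE d (subject-reduction x r)
subject-reductionE (⊢SE d) (SE₁ r)          = ⊢SE (subject-reductionE d r)
subject-reductionE (⊢nrecE d x y) (nrecE₁ r) = ⊢nrecE d (subject-reduction x r) y
subject-reductionE (⊢nrecE d x y) (nrecE₂ r) = ⊢nrecE d x (subject-reduction y r)
subject-reductionE (⊢nrecE d x y) (nrecE₃ r) = ⊢nrecE (subject-reductionE d r) x y

-- 7. Reducible terms and reducible contexts

mutual
  Red : List Ty → List Ty → Ty → Tm → Set
  Red Γ Δ ρ t = (Γ ⨾ Δ ⊢ t ∶ ρ) × SN-in-RedCtx Γ Δ ρ t

  SN-in-RedCtx : List Ty → List Ty → Ty → Tm → Set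
  SN-in-RedCtx Γ Δ ρ t =
    ∀ {Γ' Δ'} → Γ ⊆ Γ' → Δ ⊆ Δ' → ∀ E τ b → RedCtx Γ' Δ' ρ τ E → Δ' ∋ b ∶ τ → SNC (named b (plug E t))

  RedCtx : List Ty → List Ty → Ty → Ty → ECtx → Set
  RedCtx Γ Δ nat τ E = (Γ ⨾ Δ ⊢E E ∶ nat ↝ τ) ×
    (∀ {Γ' Δ'} → Γ ⊆ Γ' → Δ ⊆ Δ' → ∀ n b → Δ' ∋ b ∶ τ → SNC (named b (plug E (num n))))
  RedCtx Γ Δ (σ ⇒ ρ) τ E = ((E ≡ hole) × ((σ ⇒ ρ) ≡ τ)) ⊎
    (Σ Tm λ u → Σ ECtx λ E' → (E ≡ compE E' (appE hole u)) × Red Γ Δ σ u × RedCtx Γ Δ ρ τ E')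

Red-elim : ∀ {Γ Δ ρ τ t E b} → Red Γ Δ ρ t → RedCtx Γ Δ ρ τ E → Δ ∋ b ∶ τ → SNC (named b (plug E t))
Red-elim {E = E} {b} (_ , h) c y = h (λ x → x) (λ x → x) E _ b c y

Red-mono : ∀ {Γ Δ Γ' Δ' ρ t} → Γ ⊆ Γ' → Δ ⊆ Δ' → Red Γ Δ ρ t → Red Γ' Δ' ρ t
Red-mono a b (d , h) = ⊢mono a b d , (λ a' b' → h (a' ∘ a) (b' ∘ b))

RedCtx-mono : ∀ {Γ Δ Γ' Δ'} ρ {τ E} → Γ ⊆ Γ' → Δ ⊆ Δ' → RedCtx Γ Δ ρ τ E → RedCtx Γ' Δ' ρ τ E
RedCtx-mono nat a b (d , h)                           = ⊢monoE a b d , (λ a' b' → h (a' ∘ a) (b' ∘ b))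
RedCtx-mono (σ ⇒ ρ) a b (inj₁ x)                      = inj₁ x
RedCtx-mono (σ ⇒ ρ) a b (inj₂ (u , E' , e , r , c))   = inj₂ (u , E' , e , Red-mono a b r , RedCtx-mono ρ a b c)

RedCtx-typed : ∀ {Γ Δ} ρ {τ E} → RedCtx Γ Δ ρ τ E → Γ ⨾ Δ ⊢E E ∶ ρ ↝ τ
RedCtx-typed nat (d , _)                              = d
RedCtx-typed (σ ⇒ ρ) (inj₁ (refl , refl))             = ⊢hole
RedCtx-typed (σ ⇒ ρ) (inj₂ (u , E' , refl , r , c))   = ⊢compE (RedCtx-typed ρ c) (⊢appE ⊢hole (proj₁ r))

snc-num : ∀ b n → SNC (named b (num n))
snc-num b n = snc step
  where
  no-root : ∀ n {c'} → named b (num n) ↦Bᶜ c' → ⊥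
  no-root zero ()
  no-root (suc n) ()
  step : ∀ {c'} → named b (num n) ⟶ᶜ c' → SNC c'
  step (rootBᶜ r) = ⊥-elim (no-root n r)
  step (ξnamed r) = ⊥-elim (num-normal n r)

hole-RedCtx : ∀ {Γ Δ} ρ → RedCtx Γ Δ ρ ρ hole
hole-RedCtx nat     = ⊢hole , (λ _ _ n b _ → snc-num b n)
hole-RedCtx (σ ⇒ ρ) = inj₁ (refl , refl)

-- Reducible terms are SN: plug them into □ under a fresh name.
Red⊆SN : ∀ {Γ Δ ρ t} → Red Γ Δ ρ t → SN-AB t
Red⊆SN {Γ} {Δ} {ρ} (d , h) =
  snc→sn (h (λ x → x) (⊆-++ (ρ ∷ [])) hole ρ (length Δ) (hole-RedCtx ρ) (∋-++ Δ ρ))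

-- Reducible contexts are SN: at ℕ fill them with 0 under a fresh name.
RedCtx-SNE : ∀ {Γ Δ} ρ {τ E} → RedCtx Γ Δ ρ τ E → SNE E
RedCtx-SNE {Δ = Δ} nat {τ} (d , h) =
  sn-plug→sne `0 (snc→sn (h (λ x → x) (⊆-++ (τ ∷ [])) zero (length Δ) (∋-++ Δ τ)))
RedCtx-SNE (σ ⇒ ρ) (inj₁ (refl , _))                  = sne-hole
RedCtx-SNE (σ ⇒ ρ) (inj₂ (u , E' , refl , r , c))     = sne-compE (RedCtx-SNE ρ c) (sne-app (Red⊆SN r))

Red-⟶ : ∀ {Γ Δ ρ t t'} → Red Γ Δ ρ t → t ⟶ t' → Red Γ Δ ρ t'
Red-⟶ (d , h) r = subject-reduction d r , (λ a b E τ x c y → snc-⟶ (h a b E τ x c y) (ξnamed (plug-⟶ E r)))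

Red-⟶* : ∀ {Γ Δ ρ t t'} → Red Γ Δ ρ t → t ⟶* t' → Red Γ Δ ρ t'
Red-⟶* h ε        = h
Red-⟶* h (r ◅ rs) = Red-⟶* (Red-⟶ h r) rs

RedCtx-⟶ : ∀ {Γ Δ} ρ {τ E E'} → RedCtx Γ Δ ρ τ E → E ⟶E E' → RedCtx Γ Δ ρ τ E'
RedCtx-⟶ nat (d , h) r = subject-reductionE d r , (λ a b n x y → snc-⟶ (h a b n x y) (ξnamed (plugE-⟶ _ r)))
RedCtx-⟶ (σ ⇒ ρ) (inj₁ (refl , _)) ()
RedCtx-⟶ (σ ⇒ ρ) (inj₂ (u , E' , refl , rd , c)) r with compE-⟶-inv E' r
... | inj₁ (E'' , x , refl)                        = inj₂ (u , E'' , refl , rd , RedCtx-⟶ ρ c x)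
... | inj₂ (.(appE hole _) , appE₂ x , refl)       = inj₂ (_ , E' , refl , Red-⟶ rd x , c)

-- A normal inert term in an SN context gives an SN command: every step
-- happens inside the context.
inert-normal-SNC : ∀ {q} b → Inert q → (∀ {X} → q ⟶ X → ⊥) → ∀ {E} → SNE E → SNC (named b (plug E q))
inert-normal-SNC {q} b i normal {E} (sne f) = snc (step refl)
  where
  step : ∀ {Y c'} → Y ≡ plug E q → named b Y ⟶ᶜ c' → SNC c'
  step e (rootBᶜ μren) = ⊥-elim (inert-not-mu E i e)
  step refl (ξnamed r) with inert-plug-inv E i r
  ... | inj₁ (E' , x , refl) = inert-normal-SNC b i normal (f x)
  ... | inj₂ (q' , x , refl) = ⊥-elim (normal x)

-- 8. Closure of Red under the term formers other than μ

Red-var : ∀ {Γ Δ x ρ} → Γ ∋ x ∶ ρ → Red Γ Δ ρ (var x)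
Red-var {ρ = ρ} x = ⊢var x , λ a b E τ b' c y → inert-normal-SNC b' ivar var-normal (RedCtx-SNE ρ c)

-- An application in E is its head in the context E[□ u].
Red-app : ∀ {Γ Δ σ τ t u} → Red Γ Δ (σ ⇒ τ) t → Red Γ Δ σ u → Red Γ Δ τ (app t u)
Red-app {u = u} (dt , ht) ru@(du , _) = ⊢app dt du , λ a b E τ' b' c y →
  subst (λ z → SNC (named b' z)) (plug-compE E (appE hole u) _)
    (ht a b (compE E (appE hole u)) τ' b' (inj₂ (u , E , refl , Red-mono a b ru , c)) y)

-- Numerals are reducible by definition of RedCtx at ℕ; S t is t in E[S □].
Red-num : ∀ {Γ Δ} n → Red Γ Δ nat (num n)
Red-num n = ⊢num n , λ a b E τ b' c y → proj₂ c (λ z → z) (λ z → z) n b' y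

Red-S : ∀ {Γ Δ t} → Red Γ Δ nat t → Red Γ Δ nat (`S t)
Red-S {t = t} (d , h) = ⊢S d , λ a b E τ b' c y →
  subst (λ z → SNC (named b' z)) (plug-compE E (SE hole) t) (h a b (compE E (SE hole)) τ b' (S-ctx c) y)
  where
  S-ctx : ∀ {Γ Δ E τ} → RedCtx Γ Δ nat τ E → RedCtx Γ Δ nat τ (compE E (SE hole))
  S-ctx {E = E} (tyE , hE) = ⊢compE tyE (⊢SE ⊢hole) , λ a' b'' n b₀ y₀ →
    subst (λ z → SNC (named b₀ z)) (sym (plug-compE E (SE hole) (num n))) (hE a' b'' (suc n) b₀ y₀)

-- The body is SN because instantiating it with a fresh
-- variable is reducible; a β-redex in a reducible context is then handled by
-- induction on the SN-ness of body, argument and context.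

sub-⟶* : ∀ σ {t t'} → t ⟶ t' → sub σ t ⟶* sub σ t'
sub-⟶* σ {t} {t'} r = subst₂ _⟶*_ (sym (sub-as-gsub σ t)) (sym (sub-as-gsub σ t'))
                                   (Plus→Star (gsub-⟶-holefree σ idμ (λ _ → refl) r))

lam-SNC : ∀ {ρ t} b → SN-AB t → SNC (named b (lam ρ t))
lam-SNC b (sn f) = snc step
  where
  step : ∀ {c'} → named b (lam _ _) ⟶ᶜ c' → SNC c'
  step (rootBᶜ ())
  step (ξnamed r) with lam-⟶-inv r
  ... | t' , x , refl = lam-SNC b (f x)

β-SNC : ∀ {Γ Δ σ τ τ'} {t : Tm} → SN-AB t → ∀ {u} → SN-AB u → ∀ {E} → SNE E →
        (∀ u' → Red Γ Δ σ u' → Red Γ Δ τ (sub (single u') t)) →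
        Red Γ Δ σ u → RedCtx Γ Δ τ τ' E → ∀ b → Δ ∋ b ∶ τ' →
        SNC (named b (plug E (app (lam σ t) u)))
β-SNC {σ = σ} {τ} {t = t} (sn ft) {u} (sn fu) {E} (sne fE) body ru c b y = snc (step refl)
  where
  step : ∀ {Y c'} → Y ≡ plug E (app (lam σ t) u) → named b Y ⟶ᶜ c' → SNC c'
  step e (rootBᶜ μren) = ⊥-elim (inert-not-mu E iapp e)
  step refl (ξnamed r) with inert-plug-inv E iapp r
  ... | inj₁ (E' , x , refl)              = β-SNC (sn ft) (sn fu) (fE x) body ru (RedCtx-⟶ τ c x) b y
  ... | inj₂ (q' , rootA β , refl)        = Red-elim (body u ru) c y
  ... | inj₂ (q' , ξappL (ξlam x) , refl) =
    β-SNC (ft x) (sn fu) (sne fE) (λ u' ru' → Red-⟶* (body u' ru') (sub-⟶* (single u') x)) ru c b y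
  ... | inj₂ (q' , ξappL (rootA ()) , refl)
  ... | inj₂ (q' , ξappL (rootB ()) , refl)
  ... | inj₂ (q' , ξappR x , refl)        = β-SNC (sn ft) (fu x) (sne fE) body (Red-⟶ ru x) c b y

Red-lam : ∀ {Γ Δ σ τ t} → (σ ∷ Γ) ⨾ Δ ⊢ t ∶ τ →
          (∀ {Γ' Δ'} → Γ ⊆ Γ' → Δ ⊆ Δ' → ∀ u → Red Γ' Δ' σ u → Red Γ' Δ' τ (sub (single u) t)) →
          Red Γ Δ (σ ⇒ τ) (lam σ t)
Red-lam {Γ} {Δ} {σ} {τ} {t} d body = ⊢lam d , in-ctx
  where
  fresh = var (length Γ)
  sn-body : SN-AB t
  sn-body = sn-gsub-inv (single fresh) idμ (λ _ → refl)
    (subst SN-AB (sub-as-gsub _ t) (Red⊆SN (body (⊆-++ (σ ∷ [])) (λ z → z) fresh (Red-var (∋-++ Γ σ)))))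
  in-ctx : SN-in-RedCtx Γ Δ (σ ⇒ τ) (lam σ t)
  in-ctx a b' E τ' b (inj₁ (refl , refl)) y = lam-SNC b sn-body
  in-ctx a b' E τ' b (inj₂ (u , E' , refl , ru , c)) y =
    subst (λ z → SNC (named b z)) (sym (plug-compE E' (appE hole u) (lam σ t)))
      (β-SNC sn-body (Red⊆SN ru) (RedCtx-SNE τ c) (body a b') ru c b y)

-- The recursor on a numeral: induction on n, and for fixed n on the SN-ness
-- of the two branches and of the context.  NrecBelow n is the hypothesis
-- for the predecessor of n.

NrecBelow : ℕ → Set
NrecBelow n = ∀ m → `S (num m) ≡ num n → ∀ {Γ Δ ρ r s} →
              Red Γ Δ ρ r → Red Γ Δ (nat ⇒ ρ ⇒ ρ) s → Red Γ Δ ρ (nrec ρ r s (num m))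

nrec-num-SNC : ∀ n → NrecBelow n → ∀ {Γ Δ ρ τ r s} → SN-AB r → SN-AB s → ∀ {E} → SNE E →
               Red Γ Δ ρ r → Red Γ Δ (nat ⇒ ρ ⇒ ρ) s → RedCtx Γ Δ ρ τ E → ∀ b → Δ ∋ b ∶ τ →
               SNC (named b (plug E (nrec ρ r s (num n))))
nrec-num-SNC n below {ρ = ρ} {τ} {r} {s} (sn fr) (sn fs) {E} (sne fE) rr rs c b y = snc (step refl)
  where
  root : ∀ {Z q'} → Z ≡ num n → nrec ρ r s Z ⟶ q' → SNC (named b (plug E q'))
  root e (rootA nrec0)     = Red-elim rr c y
  root e (rootA (nrecS m)) = Red-elim (Red-app (Red-app rs (Red-num m)) (below m e rr rs)) c y
  root e (rootA μnrec)     = ⊥-elim (mu≢num n e)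
  root refl (ξnrec₁ x)     = nrec-num-SNC n below (fr x) (sn fs) (sne fE) (Red-⟶ rr x) rs c b y
  root refl (ξnrec₂ x)     = nrec-num-SNC n below (sn fr) (fs x) (sne fE) rr (Red-⟶ rs x) c b y
  root refl (ξnrec₃ x)     = ⊥-elim (num-normal n x)
  step : ∀ {Y c'} → Y ≡ plug E (nrec ρ r s (num n)) → named b Y ⟶ᶜ c' → SNC c'
  step e (rootBᶜ μren) = ⊥-elim (inert-not-mu E inrec e)
  step refl (ξnamed x) with inert-plug-inv E inrec x
  ... | inj₁ (E' , x' , refl) = nrec-num-SNC n below (sn fr) (sn fs) (fE x') rr rs (RedCtx-⟶ ρ c x') b y
  ... | inj₂ (q' , x' , refl) = root refl x'

Red-nrec-num : ∀ n {Γ Δ ρ r s} → Red Γ Δ ρ r → Red Γ Δ (nat ⇒ ρ ⇒ ρ) s → Red Γ Δ ρ (nrec ρ r s (num n))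
Red-nrec-num n {ρ = ρ} rr rs = ⊢nrec (proj₁ rr) (proj₁ rs) (⊢num n) , λ a b E τ b' c y →
  nrec-num-SNC n (below n) (Red⊆SN rr) (Red⊆SN rs) (RedCtx-SNE ρ c) (Red-mono a b rr) (Red-mono a b rs) c b' y
  where
  below : ∀ n → NrecBelow n
  below zero m ()
  below (suc n') m e rr' rs' =
    subst (λ k → Red _ _ _ (nrec _ _ _ (num k))) (sym (num-injective (S-injective e))) (Red-nrec-num n' rr' rs')

-- nrec r s t is t in the context E[nrec r s □], which is reducible at ℕ by
-- the numeral case.
Red-nrec : ∀ {Γ Δ ρ r s t} → Red Γ Δ ρ r → Red Γ Δ (nat ⇒ ρ ⇒ ρ) s → Red Γ Δ nat t → Red Γ Δ ρ (nrec ρ r s t)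
Red-nrec {Γ} {Δ} {ρ} {r} {s} {t} rr rs (dt , ht) = ⊢nrec (proj₁ rr) (proj₁ rs) dt , λ a b E τ b' c y →
  subst (λ z → SNC (named b' z)) (plug-compE E (nrecE ρ r s hole) t)
    (ht a b (compE E (nrecE ρ r s hole)) τ b' (nrec-ctx a b c) y)
  where
  nrec-ctx : ∀ {Γ' Δ' E τ} → Γ ⊆ Γ' → Δ ⊆ Δ' → RedCtx Γ' Δ' ρ τ E → RedCtx Γ' Δ' nat τ (compE E (nrecE ρ r s hole))
  nrec-ctx {E = E} a b c =
    ⊢compE (RedCtx-typed ρ c) (⊢nrecE ⊢hole (⊢mono a b (proj₁ rr)) (⊢mono a b (proj₁ rs))) , λ a' b'' n b₀ y₀ →
      subst (λ z → SNC (named b₀ z)) (sym (plug-compE E (nrecE ρ r s hole) (num n)))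
        (Red-elim (Red-nrec-num n (Red-mono (a' ∘ a) (b'' ∘ b) rr) (Red-mono (a' ∘ a) (b'' ∘ b) rs))
                  (RedCtx-mono ρ a' b'' c) y₀)

-- 9. The μ case

-- The induction is over an SN command w with
-- w ⟶* d[0 := b E], lexicographically on (SN-ness of w, depth of E), and for
-- fixed depth on the SN-ness of E.  A step of [b]E[μ.d] either
--   * renames at the root (E = □): the result is d[0 := b □], a reduct of w;
--   * reduces E to E': d[0 := b E] ⟶* d[0 := b E'] by monotonicity, so the
--     hypothesis is kept (or w itself has made a step);
--   * reduces d to d': d[0 := b E] makes at least one step (stability under
--     shaped substitutions), so w has made a step;
--   * is μη: the result is a reduct of d[0 := b E];
--   * lets μ absorb the innermost frame of E: the depth decreases.

Shaped-retarget : ∀ {Δ b E ρ τ} → Shape E ρ τ → Shaped (ρ ∷ Δ) (retarget b E)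
Shaped-retarget sh here      = _ , sh
Shaped-retarget sh (there x) = _ , shole

SSubRed-retarget : ∀ b {E E'} → E ⟶E E' → SSubRed (retarget b E) (retarget b E')
SSubRed-retarget b x zero    = refl , (x ◅ ε)
SSubRed-retarget b x (suc i) = refl , ε

module μ-Case {Γ Δ : List Ty} (b : ℕ) where

  Goal : Cmd → ℕ → Set
  Goal w n = ∀ {ρ τ} E d → depth E ≡ n → SNE E →
             w ⟶ᶜ* ssubC (retarget b E) d → Γ ⨾ (ρ ∷ Δ) ⊢ᶜ d → Γ ⨾ Δ ⊢E E ∶ ρ ↝ τ →
             SNC (named b (plug E (mu ρ d)))

  step-case : ∀ {w} → SNC w → (∀ {w₁} → w ⟶ᶜ w₁ → ∀ n → Goal w₁ n) →
              ∀ n → (∀ {m} → m < n → Goal w m) → Goal w n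
  step-case {w} sw ih-red n ih-depth {ρ} {τ} E d depth≡n (sne fE) w⟶* ⊢d ⊢E = snc (step refl)
    where
    step : ∀ {Y c'} → Y ≡ plug E (mu ρ d) → named b Y ⟶ᶜ c' → SNC c'
    step e (rootBᶜ μren) with plug-mu E e
    ... | refl , refl = snc-⟶* sw (subst (w ⟶ᶜ*_) (retarget-hole b d) w⟶*)
    step refl (ξnamed r) with mu-plug-inv E r
    ... | mr-ctx {E'} x refl = context-step (w⟶* ◅◅ retarget-⟶*)
      where
      retarget-⟶* : ssubC (retarget b E) d ⟶ᶜ* ssubC (retarget b E') d
      retarget-⟶* = subst₂ _⟶ᶜ*_ (sym (ssubC-as-gsubC _ d)) (sym (ssubC-as-gsubC _ d))
                      (gsubC-mono var (retarget b E) (retarget b E') (SSubRed-retarget b x) d)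
      context-step : w ⟶ᶜ* ssubC (retarget b E') d → SNC (named b (plug E' (mu ρ d)))
      context-step ε =
        step-case sw ih-red n ih-depth E' d (trans (depth-⟶E x) depth≡n) (fE x) ε ⊢d (subject-reductionE ⊢E x)
      context-step (z ◅ zs) = ih-red z (depth E') E' d refl (fE x) zs ⊢d (subject-reductionE ⊢E x)
    ... | mr-body {d'} x refl with Star-Plus w⟶* body-⟶⁺
      where
      body-⟶⁺ : Plus _⟶ᶜ_ (ssubC (retarget b E) d) (ssubC (retarget b E) d')
      body-⟶⁺ = subst₂ (Plus _⟶ᶜ_) (sym (ssubC-as-gsubC _ d)) (sym (ssubC-as-gsubC _ d'))
                  (gsubC-⟶-shaped var (retarget b E) ⊢d (Shaped-retarget (⊢E→Shape ⊢E)) x)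
    ... | w₁ , z , zs = ih-red z (depth E) E d' refl (sne fE) zs (subject-reductionC ⊢d x) ⊢E
    step refl (ξnamed r) | mr-eta {t} refl refl = snc-⟶* sw (subst (w ⟶ᶜ*_) same w⟶*)
      where
      same : ssubC (retarget b E) (named zero (mren suc t)) ≡ named b (plug E t)
      same = cong (λ z → named b (plug E z)) (trans (ssub-as-gsub _ (mren suc t)) (gsub-retarget-shifted b E t))
    step refl (ξnamed r) | mr-int {E₁} {F} refl frame refl with ⊢compE-inv E₁ ⊢E
    ... | ρ₂ , ⊢F , ⊢E₁ with Frame-type frame ⊢F
    ... | refl = ih-depth shallower E₁ d₁ refl (sne-compEˡ F (sne fE)) w⟶*d₁ ⊢d₁ ⊢E₁
      where
      d₁ = ssubC (selfS (mrenE suc F)) d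
      ⊢d₁ : Γ ⨾ (ρ₂ ∷ Δ) ⊢ᶜ d₁
      ⊢d₁ = ⊢selfC (⊢mrenE there ⊢F) ⊢d
      shallower : depth E₁ < n
      shallower = subst (depth E₁ <_) (trans (sym (depth-compE-frame E₁ frame)) depth≡n) (s≤s ≤-refl)
      w⟶*d₁ : w ⟶ᶜ* ssubC (retarget b E₁) d₁
      w⟶*d₁ = subst (w ⟶ᶜ*_) (sym (retarget-after-selfS b E₁ F d)) w⟶*

  by-depth : ∀ {w} → SNC w → (∀ {w₁} → w ⟶ᶜ w₁ → ∀ n → Goal w₁ n) → ∀ n → Acc _<_ n → Goal w n
  by-depth sw ih-red n (acc smaller) = step-case sw ih-red n (λ m<n → by-depth sw ih-red _ (smaller m<n))

  by-reduction : ∀ {w} → SNC w → ∀ n → Goal w n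
  by-reduction (snc fw) n = by-depth (snc fw) (λ z → by-reduction (fw z)) n (<-wellFounded n)

μ-SNC : ∀ {Γ Δ} b {ρ τ} E d → SNC (ssubC (retarget b E) d) → SNE E →
        Γ ⨾ (ρ ∷ Δ) ⊢ᶜ d → Γ ⨾ Δ ⊢E E ∶ ρ ↝ τ → SNC (named b (plug E (mu ρ d)))
μ-SNC b E d sn-body sn-E ⊢d ⊢E = μ-Case.by-reduction b sn-body (depth E) E d refl sn-E ε ⊢d ⊢E

-- 10. The fundamental lemma

RedLSub : List Ty → List Ty → List Ty → LSub → Set
RedLSub Γ₀ Γ Δ σ = ∀ {x ρ} → Γ₀ ∋ x ∶ ρ → Red Γ Δ ρ (σ x)

RedSSub : List Ty → List Ty → List Ty → SSub → Set
RedSSub Δ₀ Γ Δ s = ∀ {α ρ} → Δ₀ ∋ α ∶ ρ → Σ Ty λ τ → RedCtx Γ Δ ρ τ (proj₂ (s α)) × (Δ ∋ proj₁ (s α) ∶ τ)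

RedLSub-typed : ∀ {Γ₀ Γ Δ σ} → RedLSub Γ₀ Γ Δ σ → TypedLSub Γ₀ Γ Δ σ
RedLSub-typed g x = proj₁ (g x)

RedSSub-typed : ∀ {Δ₀ Γ Δ s} → RedSSub Δ₀ Γ Δ s → TypedSSub Δ₀ Γ Δ s
RedSSub-typed g {ρ = ρ} x with g x
... | τ , c , y = τ , RedCtx-typed ρ c , y

RedLSub-mono : ∀ {Γ₀ Γ Δ Γ' Δ' σ} → Γ ⊆ Γ' → Δ ⊆ Δ' → RedLSub Γ₀ Γ Δ σ → RedLSub Γ₀ Γ' Δ' σ
RedLSub-mono a b g x = Red-mono a b (g x)

RedSSub-mono : ∀ {Δ₀ Γ Δ Γ' Δ' s} → Γ ⊆ Γ' → Δ ⊆ Δ' → RedSSub Δ₀ Γ Δ s → RedSSub Δ₀ Γ' Δ' s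
RedSSub-mono a b g {ρ = ρ} x with g x
... | τ , c , y = τ , RedCtx-mono ρ a b c , b y

⊢lam-inv : ∀ {Γ Δ σ t ρ} → Γ ⨾ Δ ⊢ lam σ t ∶ ρ → Σ Ty λ τ → (ρ ≡ σ ⇒ τ) × ((σ ∷ Γ) ⨾ Δ ⊢ t ∶ τ)
⊢lam-inv (⊢lam d) = _ , refl , d

⊢mu-inv : ∀ {Γ Δ σ c ρ} → Γ ⨾ Δ ⊢ mu σ c ∶ ρ → (ρ ≡ σ) × (Γ ⨾ (σ ∷ Δ) ⊢ᶜ c)
⊢mu-inv (⊢mu d) = refl , d

mutual
  fundamental : ∀ {Γ₀ Δ₀ Γ Δ σ s t ρ} → Γ₀ ⨾ Δ₀ ⊢ t ∶ ρ → RedLSub Γ₀ Γ Δ σ → RedSSub Δ₀ Γ Δ s → Red Γ Δ ρ (gsub σ s t)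
  fundamental (⊢var x) gσ gs      = gσ x
  fundamental (⊢app d e) gσ gs    = Red-app (fundamental d gσ gs) (fundamental e gσ gs)
  fundamental ⊢0 gσ gs            = Red-num zero
  fundamental (⊢S d) gσ gs        = Red-S (fundamental d gσ gs)
  fundamental (⊢nrec d e g) gσ gs = Red-nrec (fundamental d gσ gs) (fundamental e gσ gs) (fundamental g gσ gs)
  -- λ: instantiating the substituted body with u is substituting u ∷λ σ.
  fundamental {σ = σ} {s} (⊢lam {σ'} {τ} {t} d) gσ gs
    with ⊢lam-inv (⊢gsub (RedLSub-typed gσ) (RedSSub-typed gs) (⊢lam d))
  ... | _ , refl , ⊢body = Red-lam ⊢body instantiate
    where
    instantiate : ∀ {Γ' Δ'} → _ ⊆ Γ' → _ ⊆ Δ' → ∀ u → Red Γ' Δ' σ' u →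
                  Red Γ' Δ' τ (sub (single u) (gsub (liftS σ) (liftλ s) t))
    instantiate a b u ru =
      subst (Red _ _ τ) (sym (single-gsub-liftS σ s u t)) (fundamental d gσ' (RedSSub-mono a b gs))
      where
      gσ' : RedLSub (σ' ∷ _) _ _ (u ∷λ σ)
      gσ' here      = ru
      gσ' (there x) = Red-mono a b (gσ x)
  -- μ: retargeting the substituted body to [b]E is substituting extμ s (b , E).
  fundamental {σ = σ} {s} (⊢mu {ρ} {c} dc) gσ gs
    with ⊢mu-inv (⊢gsub (RedLSub-typed gσ) (RedSSub-typed gs) (⊢mu dc))
  ... | refl , ⊢body = ⊢mu ⊢body , in-ctx
    where
    in-ctx : SN-in-RedCtx _ _ ρ (mu ρ (gsubC (liftSμ σ) (liftμ s) c))
    in-ctx a b E τ b' cE y =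
      μ-SNC b' E _ (subst SNC (sym (retarget-gsubC-liftμ σ s b' E c)) (fundamentalC dc (RedLSub-mono a b gσ) gs'))
            (RedCtx-SNE ρ cE) (⊢monoC a (lift⊆ b) ⊢body) (RedCtx-typed ρ cE)
      where
      gs' : RedSSub (ρ ∷ _) _ _ (extμ s (b' , E))
      gs' here      = τ , cE , y
      gs' (there x) = RedSSub-mono a b gs x

  fundamentalC : ∀ {Γ₀ Δ₀ Γ Δ σ s c} → Γ₀ ⨾ Δ₀ ⊢ᶜ c → RedLSub Γ₀ Γ Δ σ → RedSSub Δ₀ Γ Δ s → SNC (gsubC σ s c)
  fundamentalC (⊢named d x) gσ gs with gs x
  ... | τ , cE , y = Red-elim (fundamental d gσ gs) cE y

var-RedLSub : ∀ {Γ Δ} → RedLSub Γ Γ Δ var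
var-RedLSub x = Red-var x

idμ-RedSSub : ∀ {Γ Δ} → RedSSub Δ Γ Δ idμ
idμ-RedSSub {ρ = ρ} x = ρ , hole-RedCtx ρ , x

theorem6p34 : ∀ {Γ Δ : List Ty} {t : Tm} {ρ : Ty} → Γ ⨾ Δ ⊢ t ∶ ρ → SN-AB t
theorem6p34 {Γ} {Δ} {t} {ρ} d = Red⊆SN t-reducible
  where
  t-reducible : Red Γ Δ ρ t
  t-reducible = subst (Red Γ Δ ρ) (gsub-id t) (fundamental d var-RedLSub idμ-RedSSub)
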